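{- For $n\geqslant 2$ and $1\leqslant j\leqslant n-1$, $$C_{n-1,j}=\sum_{i_2+i_3+\cdots+i_n=n-j}\gamma(n;j,i_2,\ldots,i_{n-1},i_n),$$ the sum being over sequences $(i_2,\ldots,i_n)$ of nonnegative integers with the indicated sum.
   Context: The second-order Eulerian number $C_{m,j}$ is the number of Stirling permutations of order $m$ (permutations $\sigma_1\cdots\sigma_{2m}$ of the multiset $\{1,1,2,2,\ldots,m,m\}$ such that for each $i$ all entries between the two occurrences of $i$ are larger than $i$) having exactly $j$ descents, where, with $\sigma_{2m+1}=0$, a descent is an index $1\leqslant i\leqslant 2m$ with $\sigma_i>\sigma_{i+1}$. For a sequence $(i_1,\ldots,i_n)$ of nonnegative integers, $\gamma(n;i_1,\ldots,i_n)$ is the number of increasing plane trees on $[n]$ (rooted trees on $[n]$ with root $1$, children of each vertex linearly ordered, labels increasing along every path from the root) having exactly $i_\ell$ vertices with $\ell-1$ children, for every $1\leqslant \ell\leqslant n$. -}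

module Defs where

open import Data.Nat using (ℕ; zero; suc; _+_; _*_; _∸_; _≡ᵇ_; _<ᵇ_)
open import Data.Bool using (Bool; true; false; _∧_; not; if_then_else_)
open import Data.List using (List; []; _∷_; _++_; map; concatMap; length; filterᵇ; upTo)

allᵇ : {A : Set} → (A → Bool) → List A → Bool
allᵇ p []       = true
allᵇ p (x ∷ xs) = p x ∧ allᵇ p xs

oneTo : ℕ → List ℕ
oneTo n = map suc (upTo n)

occ : ℕ → List ℕ → ℕ
occ x []       = 0
occ x (y ∷ ys) = (if x ≡ᵇ y then 1 else 0) + occ x ys

countᵇ : {A : Set} → (A → Bool) → List A → ℕ
countᵇ p xs = length (filterᵇ p xs)

listEqᵇ : List ℕ → List ℕ → Bool
listEqᵇ []       []       = true
listEqᵇ (x ∷ xs) (y ∷ ys) = (x ≡ᵇ y) ∧ listEqᵇ xs ys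
listEqᵇ _        _        = false

allSeqs : ℕ → ℕ → List (List ℕ)
allSeqs zero    m = [] ∷ []
allSeqs (suc k) m = concatMap (λ x → map (x ∷_) (allSeqs k m)) (oneTo m)

afterFirst : ℕ → List ℕ → List ℕ
afterFirst i []       = []
afterFirst i (x ∷ xs) = if x ≡ᵇ i then xs else afterFirst i xs

beforeFirst : ℕ → List ℕ → List ℕ
beforeFirst i []       = []
beforeFirst i (x ∷ xs) = if x ≡ᵇ i then [] else x ∷ beforeFirst i xs

between : ℕ → List ℕ → List ℕ
between i σ = beforeFirst i (afterFirst i σ)

-- σ (a sequence with entries in {1..m}) is a Stirling permutation of order m:
-- a permutation of {1,1,…,m,m} (each i ∈ [m] occurs exactly twice) such that
-- all entries between the two occurrences of i are larger than i.
isStirlingᵇ : ℕ → List ℕ → Bool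
isStirlingᵇ m σ =
  (length σ ≡ᵇ 2 * m)
  ∧ allᵇ (λ i → occ i σ ≡ᵇ 2) (oneTo m)
  ∧ allᵇ (λ i → allᵇ (λ x → i <ᵇ x) (between i σ)) (oneTo m)

adjDesc : List ℕ → ℕ
adjDesc []            = 0
adjDesc (x ∷ [])      = 0
adjDesc (x ∷ y ∷ ys)  = (if y <ᵇ x then 1 else 0) + adjDesc (y ∷ ys)

-- descents of σ₁⋯σ_{2m} with the convention σ_{2m+1} = 0
des : List ℕ → ℕ
des σ = adjDesc (σ ++ (0 ∷ []))

C : ℕ → ℕ → ℕ
C m j = countᵇ (λ σ → isStirlingᵇ m σ ∧ (des σ ≡ᵇ j)) (allSeqs (2 * m) m)

data PTree : Set where
  node : ℕ → List PTree → PTree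

root : PTree → ℕ
root (node l _) = l

mutual
  labelsT : PTree → List ℕ
  labelsT (node l cs) = l ∷ labelsF cs

  labelsF : List PTree → List ℕ
  labelsF []       = []
  labelsF (t ∷ ts) = labelsT t ++ labelsF ts

mutual
  increasingT : PTree → Bool
  increasingT (node l cs) = increasingF l cs

  increasingF : ℕ → List PTree → Bool
  increasingF l []       = true
  increasingF l (t ∷ ts) = (l <ᵇ root t) ∧ increasingT t ∧ increasingF l ts

mutual
  nChildrenT : ℕ → PTree → ℕ
  nChildrenT k (node l cs) = (if length cs ≡ᵇ k then 1 else 0) + nChildrenF k cs

  nChildrenF : ℕ → List PTree → ℕ
  nChildrenF k []       = 0
  nChildrenF k (t ∷ ts) = nChildrenT k t + nChildrenF k ts

isIPTᵇ : ℕ → PTree → Bool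
isIPTᵇ n t =
  (length (labelsT t) ≡ᵇ n)
  ∧ allᵇ (λ k → occ k (labelsT t) ≡ᵇ 1) (oneTo n)
  ∧ (root t ≡ᵇ 1)
  ∧ increasingT t

-- all plane forests with exactly s vertices, labels drawn from L
-- (fuel argument; complete as soon as fuel > s)
forests : ℕ → List ℕ → ℕ → List (List PTree)
forests zero    L s       = []
forests (suc k) L zero    = [] ∷ []
forests (suc k) L (suc s) =
  concatMap (λ a →
    concatMap (λ l →
      concatMap (λ cs →
        map (λ rest → node l cs ∷ rest) (forests k L (s ∸ a)))
      (forests k L a))
    L)
  (upTo (suc s))

candidateTrees : ℕ → List PTree
candidateTrees zero    = []
candidateTrees (suc m) =
  concatMap (λ l → map (node l) (forests (suc m) (oneTo (suc m)) m)) (oneTo (suc m))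

-- degree profile (i₁,…,iₙ): i_ℓ = number of vertices with ℓ-1 children
profile : ℕ → PTree → List ℕ
profile n t = map (λ k → nChildrenT k t) (upTo n)

γ : ℕ → List ℕ → ℕ
γ n is = countᵇ (λ t → isIPTᵇ n t ∧ listEqᵇ (profile n t) is) (candidateTrees n)

weakComps : ℕ → ℕ → List (List ℕ)
weakComps zero    zero    = [] ∷ []
weakComps zero    (suc t) = []
weakComps (suc p) t       = concatMap (λ a → map (a ∷_) (weakComps p (t ∸ a))) (upTo (suc t))

-- Both sides satisfy the recurrence of the second-order Eulerian numbers. The two copies of the largest
-- letter m + 1 of a Stirling permutation are adjacent, so the permutations of order m + 1 arise exactly once
-- each by putting the block (m + 1)(m + 1) into one of the 2m + 1 gaps of a permutation of order m; if that
-- permutation has d descents, d gaps keep d descents and the other 2m + 1 − d give d + 1. Likewise the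
-- largest label of an increasing plane tree is a leaf, and a tree on [m + 1] with d leaves has 2m + 1 places
-- for a new leaf, of which the d places below a leaf keep d leaves and the others give d + 1. So C (m , j) and
-- the number of increasing plane trees on [m + 1] with j leaves agree, starting from m = 1. Finally the
-- degree profile of a tree on n vertices is a weak composition of n whose first entry is its number of leaves,
-- so the sum of the γ's with i₁ = j counts the trees with j leaves.
module Submission where

open import Defs
open import Data.Nat using (ℕ; zero; suc; _+_; _*_; _∸_; _≤_; _<_; z≤n; s≤s; _≡ᵇ_; _<ᵇ_; _≟_; _≤?_)
open import Data.Nat.Properties
open import Data.Nat.ListAction using (sum)
open import Data.Nat.ListAction.Properties using (sum-++; sum-↭)
open import Data.Nat.Tactic.RingSolver using (solve-∀)
open import Algebra.Properties.CommutativeSemigroup *-commutativeSemigroup using (x∙yz≈y∙xz)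
open import Data.Bool using (Bool; true; false; _∧_; if_then_else_; T)
open import Data.Bool.Properties using (T-∧; T-≡; T?)
open import Data.List using (List; []; _∷_; _++_; map; concatMap; length; filter; filterᵇ; upTo; applyUpTo)
open import Data.List.Properties
  using (map-++; ∷-injectiveˡ; ∷-injectiveʳ; ++-assoc; length-++; length-map; length-applyUpTo; upTo-∷ʳ;
         filter-++; filter-all; filter-reject)
open import Data.List.Membership.Propositional using (_∈_; _∉_; find; lose)
open import Data.List.Membership.Propositional.Properties
  using (∈-map⁺; ∈-map⁻; ∈-++⁺ˡ; ∈-++⁺ʳ; ∈-++⁻; ∈-upTo⁺; ∈-upTo⁻; ∈-filter⁺; ∈-filter⁻; ∈-concatMap⁺; ∈-concatMap⁻)
open import Data.List.Membership.Propositional.Properties.WithK using (unique∧set⇒bag)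
open import Data.List.Relation.Unary.Any using (here; there)
open import Data.List.Relation.Unary.All as All using (All; [])
open import Data.List.Relation.Unary.Unique.Propositional using (Unique; []; _∷_)
open import Data.List.Relation.Unary.Unique.Propositional.Properties as Unique using (Unique[x∷xs]⇒x∉xs)
open import Data.List.Relation.Binary.BagAndSetEquality using (∼bag⇒↭)
open import Data.List.Relation.Binary.Permutation.Propositional.Properties as Perm using ()
open import Data.Product using (∃; ∃₂; _×_; _,_; proj₁; proj₂)
open import Data.Sum using (_⊎_; inj₁; inj₂)
open import Data.Empty using (⊥-elim)
open import Data.Unit using (tt)
open import Function using (_∘_; _$_; _⇔_; mk⇔; Equivalence)
open import Relation.Nullary using (¬_; ¬?; yes; no)
open import Relation.Binary.Definitions using (Tri; tri<; tri≈; tri>)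
open import Relation.Binary.PropositionalEquality

𝟙 : Bool → ℕ
𝟙 b = if b then 1 else 0

sumBy : {A : Set} → (A → ℕ) → List A → ℕ
sumBy f xs = sum (map f xs)

syntax sumBy (λ x → e) xs = ∑[ x ← xs ] e

module _ {A : Set} where

  countᵇ≡∑𝟙 : (p : A → Bool) (xs : List A) → countᵇ p xs ≡ ∑[ x ← xs ] 𝟙 (p x)
  countᵇ≡∑𝟙 p [] = refl
  countᵇ≡∑𝟙 p (x ∷ xs) with p x
  ... | true  = cong suc (countᵇ≡∑𝟙 p xs)
  ... | false = countᵇ≡∑𝟙 p xs

  sumBy-++ : (f : A → ℕ) (xs ys : List A) → sumBy f (xs ++ ys) ≡ sumBy f xs + sumBy f ys
  sumBy-++ f xs ys = trans (cong sum (map-++ f xs ys)) (sum-++ (map f xs) (map f ys))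

  sumBy-cong : {f g : A → ℕ} (xs : List A) → (∀ {x} → x ∈ xs → f x ≡ g x) → sumBy f xs ≡ sumBy g xs
  sumBy-cong []       f≡g = refl
  sumBy-cong (x ∷ xs) f≡g = cong₂ _+_ (f≡g (here refl)) (sumBy-cong xs (f≡g ∘ there))

  sumBy-+ : (f g : A → ℕ) (xs : List A) → ∑[ x ← xs ] (f x + g x) ≡ sumBy f xs + sumBy g xs
  sumBy-+ f g []       = refl
  sumBy-+ f g (x ∷ xs) rewrite sumBy-+ f g xs = interchange (f x) (g x) (sumBy f xs) (sumBy g xs)
    where
    interchange : ∀ a b c d → a + b + (c + d) ≡ a + c + (b + d)
    interchange = solve-∀

  sumBy-*ˡ : (c : ℕ) (f : A → ℕ) (xs : List A) → ∑[ x ← xs ] (c * f x) ≡ c * sumBy f xs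
  sumBy-*ˡ c f []       = sym (*-zeroʳ c)
  sumBy-*ˡ c f (x ∷ xs) rewrite sumBy-*ˡ c f xs = sym (*-distribˡ-+ c (f x) (sumBy f xs))

  sumBy-const : (c : ℕ) (xs : List A) → ∑[ _ ← xs ] c ≡ length xs * c
  sumBy-const c []       = refl
  sumBy-const c (x ∷ xs) = cong (c +_) (sumBy-const c xs)

  sumBy-0 : (xs : List A) → ∑[ _ ← xs ] 0 ≡ 0
  sumBy-0 xs = trans (sumBy-const 0 xs) (*-zeroʳ (length xs))

  sumBy-filterᵇ : (p : A → Bool) (f : A → ℕ) (xs : List A) →
                  sumBy f (filterᵇ p xs) ≡ ∑[ x ← xs ] (𝟙 (p x) * f x)
  sumBy-filterᵇ p f [] = refl
  sumBy-filterᵇ p f (x ∷ xs) with p x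
  ... | true  = cong₂ _+_ (sym (+-identityʳ (f x))) (sumBy-filterᵇ p f xs)
  ... | false = sumBy-filterᵇ p f xs

  sumBy-sameElements : (f : A → ℕ) {xs ys : List A} → Unique xs → Unique ys →
            (∀ {x} → x ∈ xs ⇔ x ∈ ys) → sumBy f xs ≡ sumBy f ys
  sumBy-sameElements f uxs uys xs≈ys = sum-↭ (Perm.map⁺ f (∼bag⇒↭ (unique∧set⇒bag uxs uys xs≈ys)))

  sumBy-filterᵇ-sameElements : (p : A → Bool) (f : A → ℕ) {xs ys : List A} → Unique xs → Unique ys →
    (∀ {x} → x ∈ xs → T (p x) → x ∈ ys) → (∀ {x} → x ∈ ys → x ∈ xs × T (p x)) →
    ∑[ x ← xs ] (𝟙 (p x) * f x) ≡ sumBy f ys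
  sumBy-filterᵇ-sameElements p f {xs} uxs uys to from =
    trans (sym (sumBy-filterᵇ p f xs))
      (sumBy-sameElements f (Unique.filter⁺ (T? ∘ p) uxs) uys
        (mk⇔ (λ x∈ → let x∈xs , px = ∈-filter⁻ (T? ∘ p) x∈ in to x∈xs px)
             (λ x∈ → let x∈xs , px = from x∈ in ∈-filter⁺ (T? ∘ p) x∈xs px)))

module _ {A B : Set} where

  sumBy-map : (f : B → ℕ) (g : A → B) (xs : List A) → sumBy f (map g xs) ≡ ∑[ x ← xs ] f (g x)
  sumBy-map f g []       = refl
  sumBy-map f g (x ∷ xs) = cong (f (g x) +_) (sumBy-map f g xs)

  sumBy-concatMap : (f : B → ℕ) (g : A → List B) (xs : List A) →
                    sumBy f (concatMap g xs) ≡ ∑[ x ← xs ] sumBy f (g x)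
  sumBy-concatMap f g []       = refl
  sumBy-concatMap f g (x ∷ xs) =
    trans (sumBy-++ f (g x) (concatMap g xs)) (cong (sumBy f (g x) +_) (sumBy-concatMap f g xs))

  sumBy-comm : (f : A → B → ℕ) (xs : List A) (ys : List B) →
               ∑[ x ← xs ] ∑[ y ← ys ] f x y ≡ ∑[ y ← ys ] ∑[ x ← xs ] f x y
  sumBy-comm f []       ys = sym (sumBy-0 ys)
  sumBy-comm f (x ∷ xs) ys = trans (cong (sumBy (f x) ys +_) (sumBy-comm f xs ys))
                                   (sym (sumBy-+ (f x) (λ y → ∑[ x ← xs ] f x y) ys))

  ∈-concatMap⁺′ : (g : A → List B) {x : A} {y : B} {xs : List A} → x ∈ xs → y ∈ g x → y ∈ concatMap g xs
  ∈-concatMap⁺′ g x∈xs y∈gx = ∈-concatMap⁺ g (lose x∈xs y∈gx)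

  ∈-concatMap⁻′ : (g : A → List B) {y : B} (xs : List A) → y ∈ concatMap g xs → ∃ λ x → x ∈ xs × y ∈ g x
  ∈-concatMap⁻′ g xs y∈ = find (∈-concatMap⁻ g {xs} y∈)

  concatMap-unique : (g : A → List B) {xs : List A} → Unique xs → (∀ {x} → x ∈ xs → Unique (g x)) →
    (∀ {x x′ y} → x ∈ xs → x′ ∈ xs → y ∈ g x → y ∈ g x′ → x ≡ x′) → Unique (concatMap g xs)
  concatMap-unique g [] ug fibres = []
  concatMap-unique g {x ∷ xs} uxxs@(_ ∷ uxs) ug fibres =
    Unique.++⁺ (ug (here refl)) (concatMap-unique g uxs (ug ∘ there) (λ x∈ x′∈ → fibres (there x∈) (there x′∈)))
      disjoint
    where
    disjoint : ∀ {y} → ¬ (y ∈ g x × y ∈ concatMap g xs)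
    disjoint (y∈gx , y∈rest) with ∈-concatMap⁻′ g xs y∈rest
    ... | x′ , x′∈xs , y∈gx′ =
      Unique[x∷xs]⇒x∉xs uxxs (subst (_∈ xs) (fibres (there x′∈xs) (here refl) y∈gx′ y∈gx) x′∈xs)

¬T⇒≡false : ∀ {b} → ¬ T b → b ≡ false
¬T⇒≡false {true}  ¬b = ⊥-elim (¬b tt)
¬T⇒≡false {false} ¬b = refl

≡ᵇ-refl : ∀ n → (n ≡ᵇ n) ≡ true
≡ᵇ-refl n = Equivalence.to T-≡ (≡⇒≡ᵇ n n refl)

≢⇒≡ᵇ≡false : ∀ {m n} → m ≢ n → (m ≡ᵇ n) ≡ false
≢⇒≡ᵇ≡false {m} {n} m≢n = ¬T⇒≡false (m≢n ∘ ≡ᵇ⇒≡ m n)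

<⇒<ᵇ≡true : ∀ {m n} → m < n → (m <ᵇ n) ≡ true
<⇒<ᵇ≡true = Equivalence.to T-≡ ∘ <⇒<ᵇ

≤⇒>ᵇ≡false : ∀ {m n} → n ≤ m → (m <ᵇ n) ≡ false
≤⇒>ᵇ≡false {m} {n} n≤m = ¬T⇒≡false (λ m<n → <⇒≱ (<ᵇ⇒< m n m<n) n≤m)

𝟙-∧ : ∀ a b → 𝟙 (a ∧ b) ≡ 𝟙 a * 𝟙 b
𝟙-∧ true  b = sym (+-identityʳ (𝟙 b))
𝟙-∧ false b = refl

*-𝟙≡ᵇ : ∀ d j → d * 𝟙 (d ≡ᵇ j) ≡ j * 𝟙 (d ≡ᵇ j)
*-𝟙≡ᵇ d j with d ≟ j
... | yes refl = refl
... | no  d≢j  rewrite ≢⇒≡ᵇ≡false d≢j = trans (*-zeroʳ d) (sym (*-zeroʳ j))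

T-allᵇ : {A : Set} (p : A → Bool) (xs : List A) → T (allᵇ p xs) ⇔ (∀ {x} → x ∈ xs → T (p x))
T-allᵇ p xs = mk⇔ (to xs) (from xs)
  where
  to : ∀ xs → T (allᵇ p xs) → ∀ {x} → x ∈ xs → T (p x)
  to (y ∷ ys) h (here refl) = proj₁ (Equivalence.to T-∧ h)
  to (y ∷ ys) h (there x∈)  = to ys (proj₂ (Equivalence.to T-∧ h)) x∈
  from : ∀ xs → (∀ {x} → x ∈ xs → T (p x)) → T (allᵇ p xs)
  from []       h = tt
  from (y ∷ ys) h = Equivalence.from T-∧ (h (here refl) , from ys (h ∘ there))

∈-oneTo⁻ : ∀ {m x} → x ∈ oneTo m → 0 < x × x ≤ m
∈-oneTo⁻ x∈ with ∈-map⁻ suc x∈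
... | y , y∈ , refl = s≤s z≤n , ∈-upTo⁻ y∈

∈-oneTo⁺ : ∀ {m x} → 0 < x → x ≤ m → x ∈ oneTo m
∈-oneTo⁺ {x = suc y} _ x≤m = ∈-map⁺ suc (∈-upTo⁺ x≤m)

oneTo-unique : ∀ m → Unique (oneTo m)
oneTo-unique m = Unique.map⁺ suc-injective (Unique.upTo⁺ m)

≤-suc-≢ : ∀ {i m} → i ≤ suc m → i ≢ suc m → i ≤ m
≤-suc-≢ i≤1+m i≢1+m = ≤-pred (≤∧≢⇒< i≤1+m i≢1+m)

∈-oneTo-suc⁻ : ∀ {m x} → x ∈ oneTo (suc m) → x ≢ suc m → x ∈ oneTo m
∈-oneTo-suc⁻ x∈ x≢ = let 0<x , x≤ = ∈-oneTo⁻ x∈ in ∈-oneTo⁺ 0<x (≤-suc-≢ x≤ x≢)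

∈-oneTo-suc⁺ : ∀ {m x} → x ∈ oneTo m → x ∈ oneTo (suc m)
∈-oneTo-suc⁺ x∈ = let 0<x , x≤ = ∈-oneTo⁻ x∈ in ∈-oneTo⁺ 0<x (m≤n⇒m≤1+n x≤)

∈-oneTo⇒≢suc : ∀ {m x} → x ∈ oneTo m → x ≢ suc m
∈-oneTo⇒≢suc x∈ refl = 1+n≰n (proj₂ (∈-oneTo⁻ x∈))

occ-++ : ∀ i u v → occ i (u ++ v) ≡ occ i u + occ i v
occ-++ i []      v = refl
occ-++ i (y ∷ u) v = trans (cong (𝟙 (i ≡ᵇ y) +_) (occ-++ i u v)) (sym (+-assoc (𝟙 (i ≡ᵇ y)) _ _))

∉⇒occ≡0 : ∀ i σ → i ∉ σ → occ i σ ≡ 0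
∉⇒occ≡0 i []      i∉ = refl
∉⇒occ≡0 i (y ∷ σ) i∉ rewrite ≢⇒≡ᵇ≡false (i∉ ∘ here) = ∉⇒occ≡0 i σ (i∉ ∘ there)

occ≡0⇒∉ : ∀ i σ → occ i σ ≡ 0 → i ∉ σ
occ≡0⇒∉ i (y ∷ σ) occ≡0 (here refl) rewrite ≡ᵇ-refl i = 1+n≢0 occ≡0
occ≡0⇒∉ i (y ∷ σ) occ≡0 (there i∈) with i ≡ᵇ y
... | true  = 1+n≢0 occ≡0
... | false = occ≡0⇒∉ i σ occ≡0 i∈

occ>0⇒first : ∀ i σ → 0 < occ i σ → ∃₂ λ u w → σ ≡ u ++ i ∷ w × occ i u ≡ 0
occ>0⇒first i (y ∷ σ) 0<occ with i ≟ y
... | yes refl = [] , σ , refl , refl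
... | no  i≢y rewrite ≢⇒≡ᵇ≡false i≢y with occ>0⇒first i σ 0<occ
... | u , w , refl , occ≡0 = y ∷ u , w , refl , trans (cong (λ b → 𝟙 b + occ i u) (≢⇒≡ᵇ≡false i≢y)) occ≡0

occ-insert : ∀ i x u v → occ i (u ++ x ∷ v) ≡ 𝟙 (i ≡ᵇ x) + occ i (u ++ v)
occ-insert i x u v rewrite occ-++ i u (x ∷ v) | occ-++ i u v = +-exchange (occ i u) (𝟙 (i ≡ᵇ x)) (occ i v)
  where
  +-exchange : ∀ a b c → a + (b + c) ≡ b + (a + c)
  +-exchange = solve-∀

occ-insert-≡ : ∀ x u v → occ x (u ++ x ∷ v) ≡ suc (occ x (u ++ v))
occ-insert-≡ x u v rewrite occ-insert x x u v | ≡ᵇ-refl x = refl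

occ-insert-≢ : ∀ {i x} u v → i ≢ x → occ i (u ++ x ∷ v) ≡ occ i (u ++ v)
occ-insert-≢ {i} {x} u v i≢x rewrite occ-insert i x u v | ≢⇒≡ᵇ≡false i≢x = refl

Insertion : {A : Set} → A → List A → List A → Set
Insertion x L L′ = ∃₂ λ u v → L ≡ u ++ v × L′ ≡ u ++ x ∷ v

module _ {A : Set} where

  ∈-insert⁻ : ∀ {x y : A} u v → y ∈ u ++ x ∷ v → y ≡ x ⊎ y ∈ u ++ v
  ∈-insert⁻ []      v (here y≡x) = inj₁ y≡x
  ∈-insert⁻ []      v (there y∈) = inj₂ y∈
  ∈-insert⁻ (c ∷ u) v (here y≡c) = inj₂ (here y≡c)
  ∈-insert⁻ (c ∷ u) v (there y∈) with ∈-insert⁻ u v y∈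
  ... | inj₁ y≡x  = inj₁ y≡x
  ... | inj₂ y∈uv = inj₂ (there y∈uv)

  ∈-insert⁺ : ∀ {x y : A} u v → y ∈ u ++ v → y ∈ u ++ x ∷ v
  ∈-insert⁺ []      v y∈         = there y∈
  ∈-insert⁺ (c ∷ u) v (here y≡c) = here y≡c
  ∈-insert⁺ (c ∷ u) v (there y∈) = there (∈-insert⁺ u v y∈)

  length-insert : ∀ (x : A) u v → length (u ++ x ∷ v) ≡ suc (length (u ++ v))
  length-insert x []      v = refl
  length-insert x (y ∷ u) v = cong suc (length-insert x u v)

  insertion-++ˡ : ∀ {x : A} {L L′} K → Insertion x L L′ → Insertion x (K ++ L) (K ++ L′)
  insertion-++ˡ {x} K (u , v , refl , refl) = K ++ u , v , sym (++-assoc K u v) , sym (++-assoc K u (x ∷ v))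

  insertion-++ʳ : ∀ {x : A} {L L′} K → Insertion x L L′ → Insertion x (L ++ K) (L′ ++ K)
  insertion-++ʳ {x} K (u , v , refl , refl) = u , v ++ K , ++-assoc u v K , ++-assoc u (x ∷ v) K

  insertion-∈⁺ : ∀ {x : A} {L L′ y} → Insertion x L L′ → y ∈ L → y ∈ L′
  insertion-∈⁺ (u , v , refl , refl) = ∈-insert⁺ u v

  insertion-length : ∀ {x : A} {L L′} → Insertion x L L′ → length L′ ≡ suc (length L)
  insertion-length {x} (u , v , refl , refl) = length-insert x u v

InsertionOrSame : ℕ → List ℕ → List ℕ → Set
InsertionOrSame x L L′ = L′ ≡ L ⊎ Insertion x L L′

insertionOrSame-∷ : ∀ {x L L′} y → InsertionOrSame x L L′ → InsertionOrSame x (y ∷ L) (y ∷ L′)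
insertionOrSame-∷ y (inj₁ refl)                 = inj₁ refl
insertionOrSame-∷ y (inj₂ (u , v , refl , refl)) = inj₂ (y ∷ u , v , refl , refl)

insertionOrSame-∈⁺ : ∀ {x L L′ y} → InsertionOrSame x L L′ → y ∈ L → y ∈ L′
insertionOrSame-∈⁺ (inj₁ refl) = λ y∈ → y∈
insertionOrSame-∈⁺ (inj₂ ins)  = insertion-∈⁺ ins

insertionOrSame-all : ∀ {x L L′} (P : ℕ → Set) → InsertionOrSame x L L′ →
                      P x → (∀ {y} → y ∈ L → P y) → ∀ {y} → y ∈ L′ → P y
insertionOrSame-all P (inj₁ refl) Px PL = PL
insertionOrSame-all P (inj₂ (u , v , refl , refl)) Px PL y∈ with ∈-insert⁻ u v y∈
... | inj₁ refl = Px
... | inj₂ y∈uv = PL y∈uv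

beforeFirst-insert : ∀ {x i} → x ≢ i → (u v : List ℕ) →
                     InsertionOrSame x (beforeFirst i (u ++ v)) (beforeFirst i (u ++ x ∷ v))
beforeFirst-insert {x} {i} x≢i [] v rewrite ≢⇒≡ᵇ≡false x≢i = inj₂ ([] , beforeFirst i v , refl , refl)
beforeFirst-insert {x} {i} x≢i (y ∷ u) v with y ≡ᵇ i
... | true  = inj₁ refl
... | false = insertionOrSame-∷ y (beforeFirst-insert x≢i u v)

afterFirst-insert : ∀ {x i} → x ≢ i → (u v : List ℕ) →
  afterFirst i (u ++ x ∷ v) ≡ afterFirst i (u ++ v) ⊎ Insertion x (afterFirst i (u ++ v)) (afterFirst i (u ++ x ∷ v))
afterFirst-insert {x} {i} x≢i [] v rewrite ≢⇒≡ᵇ≡false x≢i = inj₁ refl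
afterFirst-insert {x} {i} x≢i (y ∷ u) v with y ≡ᵇ i
... | true  = inj₂ (u , v , refl , refl)
... | false = afterFirst-insert x≢i u v

between-insert : ∀ {x i} → x ≢ i → (u v : List ℕ) → InsertionOrSame x (between i (u ++ v)) (between i (u ++ x ∷ v))
between-insert {x} {i} x≢i u v with afterFirst-insert x≢i u v
... | inj₁ eq = inj₁ (cong (beforeFirst i) eq)
... | inj₂ (a , b , eq₁ , eq₂) rewrite eq₁ | eq₂ = beforeFirst-insert x≢i a b

afterFirst-first : ∀ x u w → occ x u ≡ 0 → afterFirst x (u ++ x ∷ w) ≡ w
afterFirst-first x []      w _ rewrite ≡ᵇ-refl x = refl
afterFirst-first x (y ∷ u) w occ≡0 with x ≟ y
... | yes refl rewrite ≡ᵇ-refl x = ⊥-elim (1+n≢0 occ≡0)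
... | no  x≢y rewrite ≢⇒≡ᵇ≡false x≢y | ≢⇒≡ᵇ≡false (x≢y ∘ sym) = afterFirst-first x u w occ≡0

∈-allSeqs⁻ : ∀ k m {σ} → σ ∈ allSeqs k m → length σ ≡ k × (∀ {y} → y ∈ σ → y ∈ oneTo m)
∈-allSeqs⁻ zero    m (here refl) = refl , λ ()
∈-allSeqs⁻ (suc k) m σ∈ with ∈-concatMap⁻′ (λ x → map (x ∷_) (allSeqs k m)) (oneTo m) σ∈
... | x , x∈ , σ∈′ with ∈-map⁻ (x ∷_) σ∈′
... | τ , τ∈ , refl = let len , entries = ∈-allSeqs⁻ k m τ∈ in
  cong suc len , λ { (here refl) → x∈ ; (there y∈) → entries y∈ }

∈-allSeqs⁺ : ∀ k m {σ} → length σ ≡ k → (∀ {y} → y ∈ σ → y ∈ oneTo m) → σ ∈ allSeqs k m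
∈-allSeqs⁺ zero    m {[]}    refl entries = here refl
∈-allSeqs⁺ (suc k) m {x ∷ σ} len  entries =
  ∈-concatMap⁺′ (λ x → map (x ∷_) (allSeqs k m)) (entries (here refl))
    (∈-map⁺ (x ∷_) (∈-allSeqs⁺ k m (suc-injective len) (entries ∘ there)))

allSeqs-unique : ∀ k m → Unique (allSeqs k m)
allSeqs-unique zero    m = [] ∷ []
allSeqs-unique (suc k) m =
  concatMap-unique (λ x → map (x ∷_) (allSeqs k m)) (oneTo-unique m)
    (λ _ → Unique.map⁺ ∷-injectiveʳ (allSeqs-unique k m))
    (λ {x} {x′} _ _ σ∈ σ∈′ → let _ , _ , eq = ∈-map⁻ (x ∷_) σ∈ ; _ , _ , eq′ = ∈-map⁻ (x′ ∷_) σ∈′ in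
                             ∷-injectiveˡ (trans (sym eq) eq′))

record IsStirling (m : ℕ) (σ : List ℕ) : Set where
  field
    length≡  : length σ ≡ 2 * m
    occ≡2    : ∀ {i} → i ∈ oneTo m → occ i σ ≡ 2
    between> : ∀ {i} → i ∈ oneTo m → ∀ {y} → y ∈ between i σ → i < y

isStirlingᵇ⇔ : ∀ m σ → T (isStirlingᵇ m σ) ⇔ IsStirling m σ
isStirlingᵇ⇔ m σ = mk⇔ to from
  where
  occᵇ = λ i → occ i σ ≡ᵇ 2
  betweenᵇ = λ i → allᵇ (i <ᵇ_) (between i σ)
  to : T (isStirlingᵇ m σ) → IsStirling m σ
  to h = let len , rest = Equivalence.to T-∧ h ; occs , betweens = Equivalence.to T-∧ rest in record
    { length≡  = ≡ᵇ⇒≡ _ _ len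
    ; occ≡2    = λ i∈ → ≡ᵇ⇒≡ _ _ (Equivalence.to (T-allᵇ occᵇ (oneTo m)) occs i∈)
    ; between> = λ {i} i∈ y∈ → <ᵇ⇒< _ _
        (Equivalence.to (T-allᵇ (i <ᵇ_) _) (Equivalence.to (T-allᵇ betweenᵇ (oneTo m)) betweens i∈) y∈)
    }
  from : IsStirling m σ → T (isStirlingᵇ m σ)
  from st = Equivalence.from T-∧ (≡⇒≡ᵇ _ _ length≡ , Equivalence.from T-∧
    ( Equivalence.from (T-allᵇ occᵇ (oneTo m)) (λ i∈ → ≡⇒≡ᵇ _ _ (occ≡2 i∈))
    , Equivalence.from (T-allᵇ betweenᵇ (oneTo m))
        (λ {i} i∈ → Equivalence.from (T-allᵇ (i <ᵇ_) _) (λ y∈ → <⇒<ᵇ (between> i∈ y∈)))))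
    where open IsStirling st

insertPair : ℕ → List ℕ → List (List ℕ)
insertPair x []       = (x ∷ x ∷ []) ∷ []
insertPair x (y ∷ ys) = (x ∷ x ∷ y ∷ ys) ∷ map (y ∷_) (insertPair x ys)

∈-insertPair⁻ : ∀ x τ {σ} → σ ∈ insertPair x τ → ∃₂ λ u v → τ ≡ u ++ v × σ ≡ u ++ x ∷ x ∷ v
∈-insertPair⁻ x []       (here refl) = [] , [] , refl , refl
∈-insertPair⁻ x (y ∷ ys) (here refl) = [] , y ∷ ys , refl , refl
∈-insertPair⁻ x (y ∷ ys) (there σ∈) with ∈-map⁻ (y ∷_) σ∈
... | σ′ , σ′∈ , refl with ∈-insertPair⁻ x ys σ′∈
... | u , v , refl , refl = y ∷ u , v , refl , refl

∈-insertPair⁺ : ∀ x u v → u ++ x ∷ x ∷ v ∈ insertPair x (u ++ v)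
∈-insertPair⁺ x []      []      = here refl
∈-insertPair⁺ x []      (y ∷ v) = here refl
∈-insertPair⁺ x (y ∷ u) v       = there (∈-map⁺ (y ∷_) (∈-insertPair⁺ x u v))

insertPair-unique : ∀ x τ → x ∉ τ → Unique (insertPair x τ)
insertPair-unique x []       x∉ = [] ∷ []
insertPair-unique x (y ∷ ys) x∉ =
  All.tabulate (λ σ∈ eq → let _ , _ , eq′ = ∈-map⁻ (y ∷_) σ∈ in x∉ (here (∷-injectiveˡ (trans eq eq′))))
  ∷ Unique.map⁺ ∷-injectiveʳ (insertPair-unique x ys (x∉ ∘ there))

eraseAll : ℕ → List ℕ → List ℕ
eraseAll x = filter (λ y → ¬? (y ≟ x))

eraseAll-insertPair : ∀ x τ {σ} → x ∉ τ → σ ∈ insertPair x τ → eraseAll x σ ≡ τ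
eraseAll-insertPair x τ x∉ σ∈ with ∈-insertPair⁻ x τ σ∈
... | u , v , refl , refl = begin
  eraseAll x (u ++ x ∷ x ∷ v)               ≡⟨ filter-++ keep? u (x ∷ x ∷ v) ⟩
  eraseAll x u ++ eraseAll x (x ∷ x ∷ v)    ≡⟨ cong (eraseAll x u ++_) (trans (filter-reject keep? (_$ refl))
                                                                          (filter-reject keep? (_$ refl))) ⟩
  eraseAll x u ++ eraseAll x v              ≡⟨ cong₂ _++_ (filter-all keep? (no-x u ∈-++⁺ˡ))
                                                         (filter-all keep? (no-x v (∈-++⁺ʳ u))) ⟩
  u ++ v                                    ∎
  where
  open ≡-Reasoning
  keep? = λ y → ¬? (y ≟ x)
  no-x : ∀ w → (∀ {y} → y ∈ w → y ∈ u ++ v) → All (_≢ x) w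
  no-x w w⊆τ = All.tabulate (λ { y∈ refl → x∉ (w⊆τ y∈) })

module _ (m : ℕ) where

  private
    x = suc m

    x∈oneTo : x ∈ oneTo x
    x∈oneTo = ∈-oneTo⁺ (s≤s z≤n) ≤-refl

    length-insertPair : ∀ u v → length (u ++ x ∷ x ∷ v) ≡ suc (suc (length (u ++ v)))
    length-insertPair u v = trans (length-insert x u (x ∷ v)) (cong suc (length-insert x u v))

    occ-insertPair-≡ : ∀ u v → occ x (u ++ x ∷ x ∷ v) ≡ suc (suc (occ x (u ++ v)))
    occ-insertPair-≡ u v = trans (occ-insert-≡ x u (x ∷ v)) (cong suc (occ-insert-≡ x u v))

    occ-insertPair-≢ : ∀ {i} u v → i ≢ x → occ i (u ++ x ∷ x ∷ v) ≡ occ i (u ++ v)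
    occ-insertPair-≢ u v i≢x = trans (occ-insert-≢ u (x ∷ v) i≢x) (occ-insert-≢ u v i≢x)

    2*suc : 2 * suc m ≡ suc (suc (2 * m))
    2*suc = *-suc 2 m

  insertPair-stirling : ∀ {τ σ} → τ ∈ allSeqs (2 * m) m → IsStirling m τ → σ ∈ insertPair x τ →
                        σ ∈ allSeqs (2 * x) x × IsStirling x σ
  insertPair-stirling {τ} τ∈ st σ∈ with ∈-insertPair⁻ x τ σ∈
  ... | u , v , refl , refl = ∈-allSeqs⁺ (2 * x) x len entries , record
    { length≡ = len ; occ≡2 = occ≡2′ ; between> = between>′ }
    where
    open IsStirling st
    τ-entries = proj₂ (∈-allSeqs⁻ (2 * m) m τ∈)
    occ-x≡0 : occ x (u ++ v) ≡ 0
    occ-x≡0 = ∉⇒occ≡0 x (u ++ v) (λ x∈ → ∈-oneTo⇒≢suc (τ-entries x∈) refl)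
    len : length (u ++ x ∷ x ∷ v) ≡ 2 * x
    len = trans (length-insertPair u v) (trans (cong (suc ∘ suc) length≡) (sym 2*suc))
    entries : ∀ {y} → y ∈ u ++ x ∷ x ∷ v → y ∈ oneTo x
    entries y∈ with ∈-insert⁻ u (x ∷ v) y∈
    ... | inj₁ refl = x∈oneTo
    ... | inj₂ y∈′ with ∈-insert⁻ u v y∈′
    ... | inj₁ refl = x∈oneTo
    ... | inj₂ y∈τ  = ∈-oneTo-suc⁺ (τ-entries y∈τ)
    occ≡2′ : ∀ {i} → i ∈ oneTo x → occ i (u ++ x ∷ x ∷ v) ≡ 2
    occ≡2′ {i} i∈ with i ≟ x
    ... | yes refl = trans (occ-insertPair-≡ u v) (cong (suc ∘ suc) occ-x≡0)
    ... | no  i≢x  = trans (occ-insertPair-≢ u v i≢x) (occ≡2 (∈-oneTo-suc⁻ i∈ i≢x))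
    between>′ : ∀ {i} → i ∈ oneTo x → ∀ {y} → y ∈ between i (u ++ x ∷ x ∷ v) → i < y
    between>′ {i} i∈ y∈ with i ≟ x
    ... | yes refl rewrite afterFirst-first x u (x ∷ v) (m+n≡0⇒m≡0 (occ x u) (trans (sym (occ-++ x u v)) occ-x≡0))
                         | ≡ᵇ-refl x with y∈
    ... | ()
    between>′ {i} i∈ y∈ | no i≢x =
      insertionOrSame-all (i <_) (between-insert (i≢x ∘ sym) u (x ∷ v)) i<x
        (insertionOrSame-all (i <_) (between-insert (i≢x ∘ sym) u v) i<x (between> (∈-oneTo-suc⁻ i∈ i≢x))) y∈
      where i<x = ≤∧≢⇒< (proj₂ (∈-oneTo⁻ i∈)) i≢x

  -- Everything between the two copies of the largest letter would have to exceed it.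
  largest-adjacent : ∀ {σ} → (∀ {y} → y ∈ σ → y ∈ oneTo x) → IsStirling x σ → ∃₂ λ u v → σ ≡ u ++ x ∷ x ∷ v
  largest-adjacent {σ} entries st with occ>0⇒first x σ (subst (0 <_) (sym (occ≡2 x∈oneTo)) (s≤s z≤n))
    where open IsStirling st
  ... | u , [] , refl , occ-u≡0 = ⊥-elim (2≢1 (trans (sym (occ≡2 x∈oneTo))
          (trans (occ-insert-≡ x u []) (cong suc (trans (occ-++ x u []) (cong (_+ 0) occ-u≡0))))))
    where
    open IsStirling st
    2≢1 : 2 ≢ 1
    2≢1 ()
  ... | u , y ∷ v , refl , occ-u≡0 with y ≟ x
  ...   | yes refl = u , v , refl
  ...   | no  y≢x  = ⊥-elim (<⇒≱ (between> x∈oneTo y∈between) (proj₂ (∈-oneTo⁻ (entries (∈-++⁺ʳ u (there (here refl)))))))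
    where
    open IsStirling st
    y∈between : y ∈ between x (u ++ x ∷ y ∷ v)
    y∈between rewrite afterFirst-first x u (y ∷ v) occ-u≡0 | ≢⇒≡ᵇ≡false y≢x = here refl

  erasePair-stirling : ∀ {u v} → (∀ {y} → y ∈ u ++ x ∷ x ∷ v → y ∈ oneTo x) → IsStirling x (u ++ x ∷ x ∷ v) →
                       u ++ v ∈ allSeqs (2 * m) m × IsStirling m (u ++ v)
  erasePair-stirling {u} {v} entries st = ∈-allSeqs⁺ (2 * m) m len entries′ , record
    { length≡ = len ; occ≡2 = occ≡2′ ; between> = between>′ }
    where
    open IsStirling st
    occ-x≡0 : occ x (u ++ v) ≡ 0
    occ-x≡0 = suc-injective (suc-injective (trans (sym (occ-insertPair-≡ u v)) (occ≡2 x∈oneTo)))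
    len : length (u ++ v) ≡ 2 * m
    len = suc-injective (suc-injective (trans (sym (length-insertPair u v)) (trans length≡ 2*suc)))
    entries′ : ∀ {y} → y ∈ u ++ v → y ∈ oneTo m
    entries′ y∈ = ∈-oneTo-suc⁻ (entries (∈-insert⁺ u (x ∷ v) (∈-insert⁺ u v y∈)))
                               (λ { refl → occ≡0⇒∉ x (u ++ v) occ-x≡0 y∈ })
    occ≡2′ : ∀ {i} → i ∈ oneTo m → occ i (u ++ v) ≡ 2
    occ≡2′ i∈ = trans (sym (occ-insertPair-≢ u v (∈-oneTo⇒≢suc i∈))) (occ≡2 (∈-oneTo-suc⁺ i∈))
    between>′ : ∀ {i} → i ∈ oneTo m → ∀ {y} → y ∈ between i (u ++ v) → i < y
    between>′ i∈ y∈ = between> (∈-oneTo-suc⁺ i∈)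
      (insertionOrSame-∈⁺ (between-insert x≢i u (x ∷ v)) (insertionOrSame-∈⁺ (between-insert x≢i u v) y∈))
      where x≢i = ∈-oneTo⇒≢suc i∈ ∘ sym

  stirlingInsertions : List (List ℕ)
  stirlingInsertions = concatMap (insertPair x) (filterᵇ (isStirlingᵇ m) (allSeqs (2 * m) m))

  private
    stirlings = filterᵇ (isStirlingᵇ m) (allSeqs (2 * m) m)

    ∈-stirlings⁻ : ∀ {τ} → τ ∈ stirlings → τ ∈ allSeqs (2 * m) m × IsStirling m τ
    ∈-stirlings⁻ τ∈ = let τ∈′ , st = ∈-filter⁻ (T? ∘ isStirlingᵇ m) τ∈ in τ∈′ , Equivalence.to (isStirlingᵇ⇔ m _) st

    x∉stirling : ∀ {τ} → τ ∈ stirlings → x ∉ τ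
    x∉stirling τ∈ x∈ = ∈-oneTo⇒≢suc (proj₂ (∈-allSeqs⁻ (2 * m) m (proj₁ (∈-stirlings⁻ τ∈))) x∈) refl

  ∈-stirlingInsertions⁺ : ∀ {σ} → (∀ {y} → y ∈ σ → y ∈ oneTo x) → IsStirling x σ → σ ∈ stirlingInsertions
  ∈-stirlingInsertions⁺ entries st with largest-adjacent entries st
  ... | u , v , refl = let τ∈ , stτ = erasePair-stirling entries st in
    ∈-concatMap⁺′ (insertPair x) (∈-filter⁺ (T? ∘ isStirlingᵇ m) τ∈ (Equivalence.from (isStirlingᵇ⇔ m _) stτ))
      (∈-insertPair⁺ x u v)

  ∈-stirlingInsertions⁻ : ∀ {σ} → σ ∈ stirlingInsertions → σ ∈ allSeqs (2 * x) x × T (isStirlingᵇ x σ)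
  ∈-stirlingInsertions⁻ σ∈ with ∈-concatMap⁻′ (insertPair x) stirlings σ∈
  ... | τ , τ∈ , σ∈′ = let τ∈′ , stτ = ∈-stirlings⁻ τ∈ ; σ∈″ , stσ = insertPair-stirling τ∈′ stτ σ∈′ in
    σ∈″ , Equivalence.from (isStirlingᵇ⇔ x _) stσ

  stirlingInsertions-unique : Unique stirlingInsertions
  stirlingInsertions-unique =
    concatMap-unique (insertPair x) (Unique.filter⁺ (T? ∘ isStirlingᵇ m) (allSeqs-unique (2 * m) m))
      (λ τ∈ → insertPair-unique x _ (x∉stirling τ∈))
      (λ τ∈ τ′∈ σ∈ σ∈′ → trans (sym (eraseAll-insertPair x _ (x∉stirling τ∈) σ∈))
                               (eraseAll-insertPair x _ (x∉stirling τ′∈) σ∈′))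

desFrom : ℕ → List ℕ → ℕ
desFrom p w = adjDesc (p ∷ w ++ 0 ∷ [])

des≡desFrom0 : ∀ w → des w ≡ desFrom 0 w
des≡desFrom0 []      = refl
des≡desFrom0 (y ∷ w) = refl

-- Putting x x into the gap between a and b creates the descent x > b and destroys a > b: the gaps at descents
-- keep the count, the others raise it by one. The weight f is arbitrary so that the induction goes through.
desFrom-insertPair : ∀ x p (f : ℕ → ℕ) τ → (∀ {y} → y ∈ τ → y < x) → p < x →
  ∑[ σ ← insertPair x τ ] f (desFrom p σ) + desFrom p τ * f (suc (desFrom p τ)) ≡
  desFrom p τ * f (desFrom p τ) + suc (length τ) * f (suc (desFrom p τ))
desFrom-insertPair x p f [] _ p<x
  rewrite ≤⇒>ᵇ≡false (<⇒≤ p<x) | ≤⇒>ᵇ≡false (≤-refl {x}) | <⇒<ᵇ≡true (≤-trans (s≤s z≤n) p<x) with 0 <ᵇ p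
... | false = cong (_+ 0) (+-identityʳ (f 1))
... | true  = shuffle (f 1) (f 2)
  where
  shuffle : ∀ a b → a + 0 + 1 * b ≡ 1 * a + 1 * b
  shuffle = solve-∀
desFrom-insertPair x p f (y ∷ ys) τ<x p<x
  rewrite ≤⇒>ᵇ≡false (<⇒≤ p<x) | ≤⇒>ᵇ≡false (≤-refl {x}) | <⇒<ᵇ≡true (τ<x (here refl))
        | sumBy-map (λ σ → f (desFrom p σ)) (y ∷_) (insertPair x ys)
  with y <ᵇ p | desFrom-insertPair x y (λ d → f (𝟙 (y <ᵇ p) + d)) ys (τ<x ∘ there) (τ<x (here refl))
... | true  | IH = after-descent (f (suc D)) (f (suc (suc D))) D (length ys) _ IH
  where
  D = desFrom y ys
  after-descent : ∀ a b D L Σ → Σ + D * b ≡ D * a + suc L * b → a + Σ + suc D * b ≡ suc D * a + suc (suc L) * b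
  after-descent a b D L Σ IH = begin
    a + Σ + suc D * b            ≡⟨ regroup a b D Σ ⟩
    a + b + (Σ + D * b)          ≡⟨ cong (a + b +_) IH ⟩
    a + b + (D * a + suc L * b)  ≡⟨ collect a b D L ⟩
    suc D * a + suc (suc L) * b  ∎
    where
    open ≡-Reasoning
    regroup : ∀ a b D Σ → a + Σ + suc D * b ≡ a + b + (Σ + D * b)
    regroup = solve-∀
    collect : ∀ a b D L → a + b + (D * a + suc L * b) ≡ suc D * a + suc (suc L) * b
    collect = solve-∀
... | false | IH = after-ascent (f D) (f (suc D)) D (length ys) _ IH
  where
  D = desFrom y ys
  after-ascent : ∀ e a D L Σ → Σ + D * a ≡ D * e + suc L * a → a + Σ + D * a ≡ D * e + suc (suc L) * a
  after-ascent e a D L Σ IH = begin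
    a + Σ + D * a            ≡⟨ +-assoc a Σ (D * a) ⟩
    a + (Σ + D * a)          ≡⟨ cong (a +_) IH ⟩
    a + (D * e + suc L * a)  ≡⟨ collect e a D L ⟩
    D * e + suc (suc L) * a  ∎
    where
    open ≡-Reasoning
    collect : ∀ e a D L → a + (D * e + suc L * a) ≡ D * e + suc (suc L) * a
    collect = solve-∀

module ChildCount {A : Set} (selected : A → Bool) (stat : A → ℕ) (K : ℕ) (parents : List A) where

  count : ℕ → ℕ
  count j = ∑[ a ← parents ] (𝟙 (selected a) * 𝟙 (stat a ≡ᵇ j))

  -- children a is the number of children of a with statistic j: a selected parent with statistic d
  -- has d children with statistic d and K − d with statistic d + 1 (stated without subtraction).
  Splits : (A → ℕ) → ℕ → Set
  Splits children j = ∀ {a} → a ∈ parents → T (selected a) →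
    children a + stat a * 𝟙 (suc (stat a) ≡ᵇ j) ≡ stat a * 𝟙 (stat a ≡ᵇ j) + K * 𝟙 (suc (stat a) ≡ᵇ j)

  private
    weight : ∀ b {n s t u} → (T b → n + s ≡ t + K * u) → 𝟙 b * n + 𝟙 b * s ≡ 𝟙 b * t + K * (𝟙 b * u)
    weight true  {n} {s} {t} {u} h rewrite *-identityˡ n | *-identityˡ s | *-identityˡ t | *-identityˡ u = h tt
    weight false h = sym (*-zeroʳ K)

    stat-sum : ∀ j → ∑[ a ← parents ] (𝟙 (selected a) * (stat a * 𝟙 (stat a ≡ᵇ j))) ≡ j * count j
    stat-sum j = trans (sumBy-cong parents (λ {a} _ → swap (𝟙 (selected a)) (stat a) j))
                       (sumBy-*ˡ j (λ a → 𝟙 (selected a) * 𝟙 (stat a ≡ᵇ j)) parents)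
      where
      swap : ∀ s d j → s * (d * 𝟙 (d ≡ᵇ j)) ≡ j * (s * 𝟙 (d ≡ᵇ j))
      swap s d j rewrite *-𝟙≡ᵇ d j = x∙yz≈y∙xz s j (𝟙 (d ≡ᵇ j))

  weighted-sum : ∀ children j → Splits children j →
    ∑[ a ← parents ] (𝟙 (selected a) * children a) + ∑[ a ← parents ] (𝟙 (selected a) * (stat a * 𝟙 (suc (stat a) ≡ᵇ j)))
    ≡ ∑[ a ← parents ] (𝟙 (selected a) * (stat a * 𝟙 (stat a ≡ᵇ j)))
      + K * ∑[ a ← parents ] (𝟙 (selected a) * 𝟙 (suc (stat a) ≡ᵇ j))
  weighted-sum children j splits = begin
    sumBy sel·N parents + sumBy sel·S parents       ≡⟨ sym (sumBy-+ sel·N sel·S parents) ⟩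
    ∑[ a ← parents ] (sel·N a + sel·S a)           ≡⟨ sumBy-cong parents (λ {a} a∈ → weight (selected a) (splits a∈)) ⟩
    ∑[ a ← parents ] (sel·T a + K * sel·U a)       ≡⟨ sumBy-+ sel·T (λ a → K * sel·U a) parents ⟩
    sumBy sel·T parents + ∑[ a ← parents ] (K * sel·U a) ≡⟨ cong (sumBy sel·T parents +_) (sumBy-*ˡ K sel·U parents) ⟩
    sumBy sel·T parents + K * sumBy sel·U parents   ∎
    where
    open ≡-Reasoning
    sel·N = λ a → 𝟙 (selected a) * children a
    sel·S = λ a → 𝟙 (selected a) * (stat a * 𝟙 (suc (stat a) ≡ᵇ j))
    sel·T = λ a → 𝟙 (selected a) * (stat a * 𝟙 (stat a ≡ᵇ j))
    sel·U = λ a → 𝟙 (selected a) * 𝟙 (suc (stat a) ≡ᵇ j)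

  children-zero : ∀ children → Splits children 0 → ∑[ a ← parents ] (𝟙 (selected a) * children a) ≡ 0
  children-zero children splits = begin
    sumBy sel·N parents                                          ≡⟨ sym (+-identityʳ _) ⟩
    sumBy sel·N parents + 0                                      ≡⟨ cong (sumBy sel·N parents +_) (sym (vanishes λ a →
                                                                      trans (cong (𝟙 (selected a) *_) (*-zeroʳ (stat a)))
                                                                            (*-zeroʳ (𝟙 (selected a))))) ⟩
    sumBy sel·N parents + ∑[ a ← parents ] (𝟙 (selected a) * (stat a * 0)) ≡⟨ weighted-sum children 0 splits ⟩
    _ + K * ∑[ a ← parents ] (𝟙 (selected a) * 0)                ≡⟨ cong₂ (λ s t → s + K * t) (stat-sum 0)
                                                                      (vanishes λ a → *-zeroʳ (𝟙 (selected a))) ⟩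
    K * 0                                                        ≡⟨ *-zeroʳ K ⟩
    0                                                            ∎
    where
    open ≡-Reasoning
    sel·N = λ a → 𝟙 (selected a) * children a
    vanishes : {g : A → ℕ} → (∀ a → g a ≡ 0) → sumBy g parents ≡ 0
    vanishes g≡0 = trans (sumBy-cong parents (λ {a} _ → g≡0 a)) (sumBy-0 parents)

  children-suc : ∀ children j → Splits children (suc j) →
    ∑[ a ← parents ] (𝟙 (selected a) * children a) + j * count j ≡ suc j * count (suc j) + K * count j
  children-suc children j splits = begin
    sumBy sel·N parents + j * count j  ≡⟨ cong (sumBy sel·N parents +_) (sym (stat-sum j)) ⟩
    _                                  ≡⟨ weighted-sum children (suc j) splits ⟩
    _                                  ≡⟨ cong (_+ K * count j) (stat-sum (suc j)) ⟩
    suc j * count (suc j) + K * count j ∎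
    where
    open ≡-Reasoning
    sel·N = λ a → 𝟙 (selected a) * children a

-- a (m + 1, j + 1) = (j + 1) a (m, j + 1) + (2m + 1 − j) a (m, j), with the subtracted term moved to the left.
record EulerianRecurrence (a : ℕ → ℕ → ℕ) : Set where
  field
    at-zero : ∀ m → a (suc m) 0 ≡ 0
    step    : ∀ m j → a (suc m) (suc j) + j * a m j ≡ suc j * a m (suc j) + suc (2 * m) * a m j

eulerianRecurrence-unique : ∀ {a b} → EulerianRecurrence a → EulerianRecurrence b →
                            (∀ j → a 1 j ≡ b 1 j) → ∀ m j → a (suc m) j ≡ b (suc m) j
eulerianRecurrence-unique ra rb a₁≡b₁ zero    j       = a₁≡b₁ j
eulerianRecurrence-unique ra rb a₁≡b₁ (suc m) zero    = trans (at-zero ra (suc m)) (sym (at-zero rb (suc m)))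
  where open EulerianRecurrence
eulerianRecurrence-unique {a} {b} ra rb a₁≡b₁ (suc m) (suc j) = +-cancelʳ-≡ (j * a (suc m) j) _ _ (begin
  a (2 + m) (suc j) + j * a (suc m) j                      ≡⟨ step ra (suc m) j ⟩
  suc j * a (suc m) (suc j) + suc (2 * suc m) * a (suc m) j
    ≡⟨ cong₂ (λ s t → suc j * s + suc (2 * suc m) * t) (IH (suc j)) (IH j) ⟩
  suc j * b (suc m) (suc j) + suc (2 * suc m) * b (suc m) j ≡⟨ step rb (suc m) j ⟨
  b (2 + m) (suc j) + j * b (suc m) j                      ≡⟨ cong (λ s → b (2 + m) (suc j) + j * s) (IH j) ⟨
  b (2 + m) (suc j) + j * a (suc m) j                      ∎)
  where
  open EulerianRecurrence
  open ≡-Reasoning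
  IH = eulerianRecurrence-unique ra rb a₁≡b₁ m

module _ (m : ℕ) where

  open ChildCount (isStirlingᵇ m) des (suc (2 * m)) (allSeqs (2 * m) m)

  private
    x = suc m

  C≡count : ∀ j → C m j ≡ count j
  C≡count j = trans (countᵇ≡∑𝟙 (λ σ → isStirlingᵇ m σ ∧ (des σ ≡ᵇ j)) (allSeqs (2 * m) m))
                    (sumBy-cong (allSeqs (2 * m) m) (λ {σ} _ → 𝟙-∧ (isStirlingᵇ m σ) (des σ ≡ᵇ j)))

  desChildren : ℕ → List ℕ → ℕ
  desChildren j τ = ∑[ σ ← insertPair x τ ] 𝟙 (des σ ≡ᵇ j)

  C-suc≡children : ∀ j → C x j ≡ ∑[ τ ← allSeqs (2 * m) m ] (𝟙 (isStirlingᵇ m τ) * desChildren j τ)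
  C-suc≡children j = begin
    C x j                                                ≡⟨ countᵇ≡∑𝟙 (λ σ → isStirlingᵇ x σ ∧ (des σ ≡ᵇ j)) seqs ⟩
    ∑[ σ ← seqs ] 𝟙 (isStirlingᵇ x σ ∧ (des σ ≡ᵇ j))     ≡⟨ sumBy-cong seqs (λ {σ} _ → 𝟙-∧ (isStirlingᵇ x σ) (des σ ≡ᵇ j)) ⟩
    ∑[ σ ← seqs ] (𝟙 (isStirlingᵇ x σ) * 𝟙 (des σ ≡ᵇ j))
      ≡⟨ reindex ⟩
    ∑[ σ ← stirlingInsertions m ] 𝟙 (des σ ≡ᵇ j)         ≡⟨ sumBy-concatMap (λ σ → 𝟙 (des σ ≡ᵇ j)) (insertPair x) stirlings ⟩
    ∑[ τ ← stirlings ] desChildren j τ                    ≡⟨ sumBy-filterᵇ (isStirlingᵇ m) (desChildren j) (allSeqs (2 * m) m) ⟩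
    ∑[ τ ← allSeqs (2 * m) m ] (𝟙 (isStirlingᵇ m τ) * desChildren j τ) ∎
    where
    open ≡-Reasoning
    seqs = allSeqs (2 * x) x
    stirlings = filterᵇ (isStirlingᵇ m) (allSeqs (2 * m) m)
    reindex : ∑[ σ ← seqs ] (𝟙 (isStirlingᵇ x σ) * 𝟙 (des σ ≡ᵇ j)) ≡ ∑[ σ ← stirlingInsertions m ] 𝟙 (des σ ≡ᵇ j)
    reindex = sumBy-filterᵇ-sameElements (isStirlingᵇ x) (λ σ → 𝟙 (des σ ≡ᵇ j))
      (allSeqs-unique (2 * x) x) (stirlingInsertions-unique m)
      (λ {σ} σ∈ stᵇ → ∈-stirlingInsertions⁺ m (proj₂ (∈-allSeqs⁻ (2 * x) x σ∈)) (Equivalence.to (isStirlingᵇ⇔ x σ) stᵇ))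
      (∈-stirlingInsertions⁻ m)

  desChildren-splits : ∀ j → Splits (desChildren j) j
  desChildren-splits j {τ} τ∈ _
    rewrite des≡desFrom0 τ | sym (proj₁ (∈-allSeqs⁻ (2 * m) m τ∈)) =
    trans (cong (_+ _) (sumBy-cong (insertPair x τ) (λ {σ} _ → cong (λ d → 𝟙 (d ≡ᵇ j)) (des≡desFrom0 σ))))
          (desFrom-insertPair x 0 (λ d → 𝟙 (d ≡ᵇ j)) τ (λ y∈ → s≤s (proj₂ (∈-oneTo⁻ (proj₂ (∈-allSeqs⁻ (2 * m) m τ∈) y∈))))
                              (s≤s z≤n))

  C-suc-zero : C x 0 ≡ 0
  C-suc-zero = trans (C-suc≡children 0) (children-zero (desChildren 0) (desChildren-splits 0))

  C-suc-step : ∀ j → C x (suc j) + j * C m j ≡ suc j * C m (suc j) + suc (2 * m) * C m j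
  C-suc-step j = begin
    C x (suc j) + j * C m j                   ≡⟨ cong₂ (λ s t → s + j * t) (C-suc≡children (suc j)) (C≡count j) ⟩
    _                                         ≡⟨ children-suc (desChildren (suc j)) j (desChildren-splits (suc j)) ⟩
    _                                         ≡⟨ cong₂ (λ s t → suc j * s + suc (2 * m) * t) (C≡count (suc j)) (C≡count j) ⟨
    suc j * C m (suc j) + suc (2 * m) * C m j ∎
    where open ≡-Reasoning

C-eulerianRecurrence : EulerianRecurrence C
C-eulerianRecurrence = record { at-zero = C-suc-zero ; step = C-suc-step }

sizeT : PTree → ℕ
sizeT t = length (labelsT t)

sizeF : List PTree → ℕ
sizeF cs = length (labelsF cs)

leaf : ℕ → PTree
leaf x = node x []

children : PTree → List PTree
children (node _ cs) = cs

root∈labelsT : ∀ t → root t ∈ labelsT t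
root∈labelsT (node l cs) = here refl

node-injective : ∀ {l cs cs′} → node l cs ≡ node l cs′ → cs ≡ cs′
node-injective refl = refl

insertChild : PTree → List PTree → List (List PTree)
insertChild s []       = (s ∷ []) ∷ []
insertChild s (c ∷ cs) = (s ∷ c ∷ cs) ∷ map (c ∷_) (insertChild s cs)

mutual
  addLeaf : ℕ → PTree → List PTree
  addLeaf x (node l cs) = map (node l) (insertChild (leaf x) cs) ++ map (node l) (addLeafF x cs)

  -- x goes below one of the trees, never next to them
  addLeafF : ℕ → List PTree → List (List PTree)
  addLeafF x []       = []
  addLeafF x (c ∷ cs) = map (_∷ cs) (addLeaf x c) ++ map (c ∷_) (addLeafF x cs)

mutual
  removeLeaf : ℕ → PTree → PTree
  removeLeaf x (node l cs) = node l (removeLeafF x cs)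

  removeLeafF : ℕ → List PTree → List PTree
  removeLeafF x []       = []
  removeLeafF x (c ∷ cs) = if root c ≡ᵇ x then cs else removeLeaf x c ∷ removeLeafF x cs

∷-∈-insertChild : ∀ s cs → s ∷ cs ∈ insertChild s cs
∷-∈-insertChild s []       = here refl
∷-∈-insertChild s (c ∷ cs) = here refl

insertChild-insertion : ∀ x cs {cs′} → cs′ ∈ insertChild (leaf x) cs → Insertion x (labelsF cs) (labelsF cs′)
insertChild-insertion x []       (here refl) = [] , [] , refl , refl
insertChild-insertion x (c ∷ cs) (here refl) = [] , labelsF (c ∷ cs) , refl , refl
insertChild-insertion x (c ∷ cs) (there cs′∈) with ∈-map⁻ (c ∷_) cs′∈
... | w , w∈ , refl = insertion-++ˡ (labelsT c) (insertChild-insertion x cs w∈)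

mutual
  addLeaf-insertion : ∀ x t {t′} → t′ ∈ addLeaf x t → Insertion x (labelsT t) (labelsT t′)
  addLeaf-insertion x (node l cs) t′∈ with ∈-++⁻ (map (node l) (insertChild (leaf x) cs)) t′∈
  ... | inj₁ t′∈₁ with ∈-map⁻ (node l) t′∈₁
  ...   | w , w∈ , refl = insertion-++ˡ (l ∷ []) (insertChild-insertion x cs w∈)
  addLeaf-insertion x (node l cs) t′∈ | inj₂ t′∈₂ with ∈-map⁻ (node l) t′∈₂
  ...   | w , w∈ , refl = insertion-++ˡ (l ∷ []) (addLeafF-insertion x cs w∈)

  addLeafF-insertion : ∀ x cs {cs′} → cs′ ∈ addLeafF x cs → Insertion x (labelsF cs) (labelsF cs′)
  addLeafF-insertion x (c ∷ cs) cs′∈ with ∈-++⁻ (map (_∷ cs) (addLeaf x c)) cs′∈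
  ... | inj₁ cs′∈₁ with ∈-map⁻ (_∷ cs) cs′∈₁
  ...   | w , w∈ , refl = insertion-++ʳ (labelsF cs) (addLeaf-insertion x c w∈)
  addLeafF-insertion x (c ∷ cs) cs′∈ | inj₂ cs′∈₂ with ∈-map⁻ (c ∷_) cs′∈₂
  ...   | w , w∈ , refl = insertion-++ˡ (labelsT c) (addLeafF-insertion x cs w∈)

root-∈-map-node : ∀ {l t} css → t ∈ map (node l) css → root t ≡ l
root-∈-map-node {l} css t∈ with ∈-map⁻ (node l) t∈
... | _ , _ , refl = refl

addLeaf-root : ∀ x t {t′} → t′ ∈ addLeaf x t → root t′ ≡ root t
addLeaf-root x (node l cs) t′∈ with ∈-++⁻ (map (node l) (insertChild (leaf x) cs)) t′∈
... | inj₁ t′∈₁ = root-∈-map-node _ t′∈₁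
... | inj₂ t′∈₂ = root-∈-map-node _ t′∈₂

addLeaf-size : ∀ x t {t′} → t′ ∈ addLeaf x t → sizeT t′ ≡ suc (sizeT t)
addLeaf-size x t t′∈ = insertion-length (addLeaf-insertion x t t′∈)

insertChild-length : ∀ s cs {cs′} → cs′ ∈ insertChild s cs → length cs′ ≡ suc (length cs)
insertChild-length s []       (here refl) = refl
insertChild-length s (c ∷ cs) (here refl) = refl
insertChild-length s (c ∷ cs) (there cs′∈) with ∈-map⁻ (c ∷_) cs′∈
... | w , w∈ , refl = cong suc (insertChild-length s cs w∈)

addLeafF-length : ∀ x cs {cs′} → cs′ ∈ addLeafF x cs → length cs′ ≡ length cs
addLeafF-length x (c ∷ cs) cs′∈ with ∈-++⁻ (map (_∷ cs) (addLeaf x c)) cs′∈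
... | inj₁ cs′∈₁ with ∈-map⁻ (_∷ cs) cs′∈₁
...   | w , w∈ , refl = refl
addLeafF-length x (c ∷ cs) cs′∈ | inj₂ cs′∈₂ with ∈-map⁻ (c ∷_) cs′∈₂
...   | w , w∈ , refl = cong suc (addLeafF-length x cs w∈)

length-insertChild : ∀ s cs → length (insertChild s cs) ≡ suc (length cs)
length-insertChild s []       = refl
length-insertChild s (c ∷ cs) = cong suc (trans (length-map (c ∷_) (insertChild s cs)) (length-insertChild s cs))

increasingF-∷⁻ : ∀ l c cs → T (increasingF l (c ∷ cs)) → T (l <ᵇ root c) × T (increasingT c) × T (increasingF l cs)
increasingF-∷⁻ l c cs h = let l<c , rest = Equivalence.to T-∧ h in l<c , Equivalence.to T-∧ rest

increasingF-∷⁺ : ∀ l c cs → T (l <ᵇ root c) → T (increasingT c) → T (increasingF l cs) → T (increasingF l (c ∷ cs))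
increasingF-∷⁺ l c cs l<c inc-c inc-cs = Equivalence.from T-∧ (l<c , Equivalence.from T-∧ (inc-c , inc-cs))

insertChild-increasing : ∀ x l cs {cs′} → T (increasingF l cs) → l < x → cs′ ∈ insertChild (leaf x) cs →
                         T (increasingF l cs′)
insertChild-increasing x l []       inc l<x (here refl) = increasingF-∷⁺ l (leaf x) [] (<⇒<ᵇ l<x) tt tt
insertChild-increasing x l (c ∷ cs) inc l<x (here refl) = increasingF-∷⁺ l (leaf x) (c ∷ cs) (<⇒<ᵇ l<x) tt inc
insertChild-increasing x l (c ∷ cs) inc l<x (there cs′∈) with ∈-map⁻ (c ∷_) cs′∈
... | w , w∈ , refl = let l<c , inc-c , inc-cs = increasingF-∷⁻ l c cs inc in
  increasingF-∷⁺ l c w l<c inc-c (insertChild-increasing x l cs inc-cs l<x w∈)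

mutual
  addLeaf-increasing : ∀ x t {t′} → T (increasingT t) → (∀ {y} → y ∈ labelsT t → y < x) → t′ ∈ addLeaf x t →
                       T (increasingT t′)
  addLeaf-increasing x (node l cs) inc <x t′∈ with ∈-++⁻ (map (node l) (insertChild (leaf x) cs)) t′∈
  ... | inj₁ t′∈₁ with ∈-map⁻ (node l) t′∈₁
  ...   | w , w∈ , refl = insertChild-increasing x l cs inc (<x (here refl)) w∈
  addLeaf-increasing x (node l cs) inc <x t′∈ | inj₂ t′∈₂ with ∈-map⁻ (node l) t′∈₂
  ...   | w , w∈ , refl = addLeafF-increasing x l cs inc (<x ∘ there) w∈

  addLeafF-increasing : ∀ x l cs {cs′} → T (increasingF l cs) → (∀ {y} → y ∈ labelsF cs → y < x) →
                        cs′ ∈ addLeafF x cs → T (increasingF l cs′)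
  addLeafF-increasing x l (c ∷ cs) inc <x cs′∈ with ∈-++⁻ (map (_∷ cs) (addLeaf x c)) cs′∈
  ... | inj₁ cs′∈₁ with ∈-map⁻ (_∷ cs) cs′∈₁
  ...   | w , w∈ , refl = let l<c , inc-c , inc-cs = increasingF-∷⁻ l c cs inc in
    increasingF-∷⁺ l w cs (subst (λ r → T (l <ᵇ r)) (sym (addLeaf-root x c w∈)) l<c)
      (addLeaf-increasing x c inc-c (<x ∘ ∈-++⁺ˡ) w∈) inc-cs
  addLeafF-increasing x l (c ∷ cs) inc <x cs′∈ | inj₂ cs′∈₂ with ∈-map⁻ (c ∷_) cs′∈₂
  ...   | w , w∈ , refl = let l<c , inc-c , inc-cs = increasingF-∷⁻ l c cs inc in
    increasingF-∷⁺ l c w l<c inc-c (addLeafF-increasing x l cs inc-cs (<x ∘ ∈-++⁺ʳ (labelsT c)) w∈)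

root≢ : ∀ {x} c cs → x ∉ labelsF (c ∷ cs) → root c ≢ x
root≢ c cs x∉ refl = x∉ (∈-++⁺ˡ (root∈labelsT c))

mutual
  removeLeaf-∉ : ∀ x t → x ∉ labelsT t → removeLeaf x t ≡ t
  removeLeaf-∉ x (node l cs) x∉ = cong (node l) (removeLeafF-∉ x cs (x∉ ∘ there))

  removeLeafF-∉ : ∀ x cs → x ∉ labelsF cs → removeLeafF x cs ≡ cs
  removeLeafF-∉ x []       x∉ = refl
  removeLeafF-∉ x (c ∷ cs) x∉ rewrite ≢⇒≡ᵇ≡false (root≢ c cs x∉) =
    cong₂ _∷_ (removeLeaf-∉ x c (x∉ ∘ ∈-++⁺ˡ)) (removeLeafF-∉ x cs (x∉ ∘ ∈-++⁺ʳ (labelsT c)))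

removeLeaf-insertChild : ∀ x cs {cs′} → x ∉ labelsF cs → cs′ ∈ insertChild (leaf x) cs → removeLeafF x cs′ ≡ cs
removeLeaf-insertChild x []       x∉ (here refl) rewrite ≡ᵇ-refl x = refl
removeLeaf-insertChild x (c ∷ cs) x∉ (here refl) rewrite ≡ᵇ-refl x = refl
removeLeaf-insertChild x (c ∷ cs) x∉ (there cs′∈) with ∈-map⁻ (c ∷_) cs′∈
... | w , w∈ , refl rewrite ≢⇒≡ᵇ≡false (root≢ c cs x∉) =
  cong₂ _∷_ (removeLeaf-∉ x c (x∉ ∘ ∈-++⁺ˡ)) (removeLeaf-insertChild x cs (x∉ ∘ ∈-++⁺ʳ (labelsT c)) w∈)

mutual
  removeLeaf-addLeaf : ∀ x t {t′} → x ∉ labelsT t → t′ ∈ addLeaf x t → removeLeaf x t′ ≡ t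
  removeLeaf-addLeaf x (node l cs) x∉ t′∈ with ∈-++⁻ (map (node l) (insertChild (leaf x) cs)) t′∈
  ... | inj₁ t′∈₁ with ∈-map⁻ (node l) t′∈₁
  ...   | w , w∈ , refl = cong (node l) (removeLeaf-insertChild x cs (x∉ ∘ there) w∈)
  removeLeaf-addLeaf x (node l cs) x∉ t′∈ | inj₂ t′∈₂ with ∈-map⁻ (node l) t′∈₂
  ...   | w , w∈ , refl = cong (node l) (removeLeafF-addLeafF x cs (x∉ ∘ there) w∈)

  removeLeafF-addLeafF : ∀ x cs {cs′} → x ∉ labelsF cs → cs′ ∈ addLeafF x cs → removeLeafF x cs′ ≡ cs
  removeLeafF-addLeafF x (c ∷ cs) x∉ cs′∈ with ∈-++⁻ (map (_∷ cs) (addLeaf x c)) cs′∈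
  ... | inj₁ cs′∈₁ with ∈-map⁻ (_∷ cs) cs′∈₁
  ...   | w , w∈ , refl rewrite addLeaf-root x c w∈ | ≢⇒≡ᵇ≡false (root≢ c cs x∉) =
    cong₂ _∷_ (removeLeaf-addLeaf x c (x∉ ∘ ∈-++⁺ˡ) w∈) (removeLeafF-∉ x cs (x∉ ∘ ∈-++⁺ʳ (labelsT c)))
  removeLeafF-addLeafF x (c ∷ cs) x∉ cs′∈ | inj₂ cs′∈₂ with ∈-map⁻ (c ∷_) cs′∈₂
  ...   | w , w∈ , refl rewrite ≢⇒≡ᵇ≡false (root≢ c cs x∉) =
    cong₂ _∷_ (removeLeaf-∉ x c (x∉ ∘ ∈-++⁺ˡ)) (removeLeafF-addLeafF x cs (x∉ ∘ ∈-++⁺ʳ (labelsT c)) w∈)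

insertChild-unique : ∀ x cs → x ∉ labelsF cs → Unique (insertChild (leaf x) cs)
insertChild-unique x []       x∉ = [] ∷ []
insertChild-unique x (c ∷ cs) x∉ =
  All.tabulate (λ cs′∈ eq → let _ , _ , eq′ = ∈-map⁻ (c ∷_) cs′∈ in
                            root≢ c cs x∉ (sym (cong root (∷-injectiveˡ (trans eq eq′)))))
  ∷ Unique.map⁺ ∷-injectiveʳ (insertChild-unique x cs (x∉ ∘ ∈-++⁺ʳ (labelsT c)))

mutual
  addLeaf-unique : ∀ x t → x ∉ labelsT t → Unique (addLeaf x t)
  addLeaf-unique x (node l cs) x∉ =
    Unique.++⁺ (Unique.map⁺ node-injective (insertChild-unique x cs (x∉ ∘ there)))
               (Unique.map⁺ node-injective (addLeafF-unique x cs (x∉ ∘ there))) disjoint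
    where
    disjoint : ∀ {t′} → ¬ (t′ ∈ map (node l) (insertChild (leaf x) cs) × t′ ∈ map (node l) (addLeafF x cs))
    disjoint (t′∈₁ , t′∈₂) with ∈-map⁻ (node l) t′∈₁ | ∈-map⁻ (node l) t′∈₂
    ... | w₁ , w₁∈ , refl | w₂ , w₂∈ , eq =
      1+n≢n (trans (sym (insertChild-length (leaf x) cs w₁∈))
                   (trans (cong length (node-injective eq)) (addLeafF-length x cs w₂∈)))

  addLeafF-unique : ∀ x cs → x ∉ labelsF cs → Unique (addLeafF x cs)
  addLeafF-unique x []       x∉ = []
  addLeafF-unique x (c ∷ cs) x∉ =
    Unique.++⁺ (Unique.map⁺ ∷-injectiveˡ (addLeaf-unique x c (x∉ ∘ ∈-++⁺ˡ)))
               (Unique.map⁺ ∷-injectiveʳ (addLeafF-unique x cs (x∉ ∘ ∈-++⁺ʳ (labelsT c)))) disjoint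
    where
    disjoint : ∀ {cs′} → ¬ (cs′ ∈ map (_∷ cs) (addLeaf x c) × cs′ ∈ map (c ∷_) (addLeafF x cs))
    disjoint (cs′∈₁ , cs′∈₂) with ∈-map⁻ (_∷ cs) cs′∈₁ | ∈-map⁻ (c ∷_) cs′∈₂
    ... | w₁ , w₁∈ , refl | w₂ , w₂∈ , eq =
      1+n≢n (trans (sym (addLeaf-size x c w₁∈)) (cong sizeT (∷-injectiveˡ eq)))

mutual
  removeLeaf-increasing : ∀ x t → T (increasingT t) → T (increasingT (removeLeaf x t))
  removeLeaf-increasing x (node l cs) = removeLeafF-increasing x l cs

  removeLeafF-increasing : ∀ x l cs → T (increasingF l cs) → T (increasingF l (removeLeafF x cs))
  removeLeafF-increasing x l []       inc = tt
  removeLeafF-increasing x l (c ∷ cs) inc with root c ≡ᵇ x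
  ... | true  = proj₂ (proj₂ (increasingF-∷⁻ l c cs inc))
  ... | false = let l<c , inc-c , inc-cs = increasingF-∷⁻ l c cs inc in
    increasingF-∷⁺ l (removeLeaf x c) (removeLeafF x cs) (subst (λ r → T (l <ᵇ r)) (root-removeLeaf c) l<c)
      (removeLeaf-increasing x c inc-c) (removeLeafF-increasing x l cs inc-cs)
    where
    root-removeLeaf : ∀ c → root c ≡ root (removeLeaf x c)
    root-removeLeaf (node _ _) = refl

m+n≡1⇒ : ∀ m n → m + n ≡ 1 → (m ≡ 0 × n ≡ 1) ⊎ (m ≡ 1 × n ≡ 0)
m+n≡1⇒ zero          n       eq = inj₁ (refl , eq)
m+n≡1⇒ (suc zero)    zero    eq = inj₂ (refl , refl)
m+n≡1⇒ (suc zero)    (suc n) ()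
m+n≡1⇒ (suc (suc m)) n       ()

mutual
  addLeaf-removeLeaf : ∀ x t → root t ≢ x → occ x (labelsT t) ≡ 1 → (∀ {y} → y ∈ labelsT t → y ≤ x) →
                       T (increasingT t) → t ∈ addLeaf x (removeLeaf x t)
  addLeaf-removeLeaf x (node l cs) l≢x occ≡1 ≤x inc
    with addLeafF-removeLeafF x l cs (trans (cong (λ b → 𝟙 b + occ x (labelsF cs)) (sym (≢⇒≡ᵇ≡false (l≢x ∘ sym)))) occ≡1)
                              (≤x ∘ there) inc
  ... | inj₁ cs∈ = ∈-++⁺ˡ (∈-map⁺ (node l) cs∈)
  ... | inj₂ cs∈ = ∈-++⁺ʳ (map (node l) (insertChild (leaf x) (removeLeafF x cs))) (∈-map⁺ (node l) cs∈)

  -- The vertex x has no children, since they would carry labels larger than x.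
  addLeafF-removeLeafF : ∀ x l cs → occ x (labelsF cs) ≡ 1 → (∀ {y} → y ∈ labelsF cs → y ≤ x) → T (increasingF l cs) →
                         cs ∈ insertChild (leaf x) (removeLeafF x cs) ⊎ cs ∈ addLeafF x (removeLeafF x cs)
  addLeafF-removeLeafF x l (c ∷ cs) occ≡1 ≤x inc
    with m+n≡1⇒ (occ x (labelsT c)) (occ x (labelsF cs)) (trans (sym (occ-++ x (labelsT c) (labelsF cs))) occ≡1)
  ... | inj₁ (occ-c≡0 , occ-cs≡1)
    rewrite ≢⇒≡ᵇ≡false (λ root≡x → occ≡0⇒∉ x (labelsT c) occ-c≡0 (subst (_∈ labelsT c) root≡x (root∈labelsT c)))
          | removeLeaf-∉ x c (occ≡0⇒∉ x (labelsT c) occ-c≡0)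
    with addLeafF-removeLeafF x l cs occ-cs≡1 (≤x ∘ ∈-++⁺ʳ (labelsT c)) (proj₂ (proj₂ (increasingF-∷⁻ l c cs inc)))
  ...   | inj₁ cs∈ = inj₁ (there (∈-map⁺ (c ∷_) cs∈))
  ...   | inj₂ cs∈ = inj₂ (∈-++⁺ʳ (map (_∷ removeLeafF x cs) (addLeaf x c)) (∈-map⁺ (c ∷_) cs∈))
  addLeafF-removeLeafF x l (c ∷ cs) occ≡1 ≤x inc | inj₂ (occ-c≡1 , occ-cs≡0) with root c ≟ x
  addLeafF-removeLeafF x l (node r [] ∷ cs) occ≡1 ≤x inc | inj₂ _ | yes refl rewrite ≡ᵇ-refl r =
    inj₁ (∷-∈-insertChild (leaf r) cs)
  addLeafF-removeLeafF x l (node r (d ∷ ds) ∷ cs) occ≡1 ≤x inc | inj₂ _ | yes refl =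
    ⊥-elim (<⇒≱ (<ᵇ⇒< r (root d) (proj₁ (increasingF-∷⁻ r d ds (proj₁ (proj₂ (increasingF-∷⁻ l (node r (d ∷ ds)) cs inc))))))
                (≤x (∈-++⁺ˡ (there (∈-++⁺ˡ (root∈labelsT d))))))
  addLeafF-removeLeafF x l (c ∷ cs) occ≡1 ≤x inc | inj₂ (occ-c≡1 , occ-cs≡0) | no root≢x
    rewrite ≢⇒≡ᵇ≡false root≢x | removeLeafF-∉ x cs (occ≡0⇒∉ x (labelsF cs) occ-cs≡0) =
    inj₂ (∈-++⁺ˡ (∈-map⁺ (_∷ cs)
      (addLeaf-removeLeaf x c root≢x occ-c≡1 (≤x ∘ ∈-++⁺ˡ) (proj₁ (proj₂ (increasingF-∷⁻ l c cs inc))))))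

leaves : PTree → ℕ
leaves = nChildrenT 0

leavesF : List PTree → ℕ
leavesF = nChildrenF 0

insertChild-leaves : ∀ x cs {cs′} → cs′ ∈ insertChild (leaf x) cs → leavesF cs′ ≡ suc (leavesF cs)
insertChild-leaves x []       (here refl) = refl
insertChild-leaves x (c ∷ cs) (here refl) = refl
insertChild-leaves x (c ∷ cs) (there cs′∈) with ∈-map⁻ (c ∷_) cs′∈
... | w , w∈ , refl = trans (cong (leaves c +_) (insertChild-leaves x cs w∈)) (+-suc (leaves c) (leavesF cs))

leaves-node : ∀ l cs {k} → length cs ≡ suc k → leaves (node l cs) ≡ leavesF cs
leaves-node l cs len rewrite len = refl

mutual
  -- Of the 2 · sizeT t − 1 places for a new leaf, the leaves t places below a leaf keep the number of leaves
  -- and all others raise it by one. The weight f is arbitrary so that the induction goes through.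
  addLeaf-leaves : ∀ x (f : ℕ → ℕ) t →
    ∑[ t′ ← addLeaf x t ] f (leaves t′) + leaves t * f (suc (leaves t)) + f (suc (leaves t)) ≡
    leaves t * f (leaves t) + 2 * sizeT t * f (suc (leaves t))
  addLeaf-leaves x f (node l []) = collect (f 1) (f 2)
    where
    collect : ∀ a b → a + 0 + 1 * b + b ≡ 1 * a + 2 * 1 * b
    collect = solve-∀
  addLeaf-leaves x f (node l (c ∷ cs)) = begin
    ∑[ t′ ← addLeaf x (node l cs₊) ] f (leaves t′) + L * f (suc L) + f (suc L)
      ≡⟨ cong (λ s → s + L * f (suc L) + f (suc L)) (sumBy-++ (f ∘ leaves) (map (node l) new) (map (node l) deeper)) ⟩
    ∑[ t′ ← map (node l) new ] f (leaves t′) + ∑[ t′ ← map (node l) deeper ] f (leaves t′) + L * f (suc L) + f (suc L)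
      ≡⟨ cong (λ s → s + L * f (suc L) + f (suc L)) (cong₂ _+_ new-child-sum deeper-sum) ⟩
    suc (suc (length cs)) * f (suc L) + ∑[ cs′ ← deeper ] f (leavesF cs′) + L * f (suc L) + f (suc L)
      ≡⟨ regroup (length cs) (f (suc L)) _ L (addLeafF-leaves x f (c ∷ cs)) ⟩
    L * f L + 2 * sizeF cs₊ * f (suc L) + 2 * f (suc L)
      ≡⟨ collect L (f L) (sizeF cs₊) (f (suc L)) ⟩
    L * f L + 2 * suc (sizeF cs₊) * f (suc L)
      ∎
    where
    open ≡-Reasoning
    cs₊ = c ∷ cs
    L = leavesF cs₊
    new = insertChild (leaf x) cs₊
    deeper = addLeafF x cs₊
    new-child-sum : ∑[ t′ ← map (node l) new ] f (leaves t′) ≡ suc (suc (length cs)) * f (suc L)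
    new-child-sum = begin
      ∑[ t′ ← map (node l) new ] f (leaves t′)  ≡⟨ sumBy-map (f ∘ leaves) (node l) new ⟩
      ∑[ cs′ ← new ] f (leaves (node l cs′))    ≡⟨ sumBy-cong new (λ {cs′} cs′∈ → cong f
                                                      (trans (leaves-node l cs′ (insertChild-length (leaf x) cs₊ cs′∈))
                                                             (insertChild-leaves x cs₊ cs′∈))) ⟩
      ∑[ _ ← new ] f (suc L)                    ≡⟨ sumBy-const (f (suc L)) new ⟩
      length new * f (suc L)                    ≡⟨ cong (_* f (suc L)) (length-insertChild (leaf x) cs₊) ⟩
      suc (suc (length cs)) * f (suc L)         ∎
    deeper-sum : ∑[ t′ ← map (node l) deeper ] f (leaves t′) ≡ ∑[ cs′ ← deeper ] f (leavesF cs′)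
    deeper-sum = trans (sumBy-map (f ∘ leaves) (node l) deeper)
                       (sumBy-cong deeper (λ {cs′} cs′∈ → cong f (leaves-node l cs′ (addLeafF-length x cs₊ cs′∈))))
    regroup : ∀ k b Σ L {E} → Σ + L * b + suc k * b ≡ E → suc (suc k) * b + Σ + L * b + b ≡ E + 2 * b
    regroup k b Σ L refl = shuffle k b Σ L
      where
      shuffle : ∀ k b Σ L → suc (suc k) * b + Σ + L * b + b ≡ Σ + L * b + suc k * b + 2 * b
      shuffle = solve-∀
    collect : ∀ L a n b → L * a + 2 * n * b + 2 * b ≡ L * a + 2 * suc n * b
    collect = solve-∀

  addLeafF-leaves : ∀ x (f : ℕ → ℕ) cs →
    ∑[ cs′ ← addLeafF x cs ] f (leavesF cs′) + leavesF cs * f (suc (leavesF cs)) + length cs * f (suc (leavesF cs)) ≡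
    leavesF cs * f (leavesF cs) + 2 * sizeF cs * f (suc (leavesF cs))
  addLeafF-leaves x f []       = refl
  addLeafF-leaves x f (c ∷ cs)
    rewrite sumBy-++ (f ∘ leavesF) (map (_∷ cs) (addLeaf x c)) (map (c ∷_) (addLeafF x cs))
          | sumBy-map (f ∘ leavesF) (_∷ cs) (addLeaf x c)
          | sumBy-map (f ∘ leavesF) (c ∷_) (addLeafF x cs)
          | length-++ (labelsT c) {labelsF cs} =
    combine _ _ (leaves c) (leavesF cs) (length cs) (f (suc (leaves c + leavesF cs))) (f (leaves c + leavesF cs))
            (sizeT c) (sizeF cs)
            (addLeaf-leaves x (λ d → f (d + leavesF cs)) c)
            (subst (λ b → ∑[ cs′ ← addLeafF x cs ] f (leaves c + leavesF cs′) + leavesF cs * f b + length cs * f b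
                          ≡ leavesF cs * f (leaves c + leavesF cs) + 2 * sizeF cs * f b)
                   (+-suc (leaves c) (leavesF cs))
                   (addLeafF-leaves x (λ d → f (leaves c + d)) cs))
    where
    combine : ∀ Σ₁ Σ₂ L₁ L₂ k b a n₁ n₂ →
      Σ₁ + L₁ * b + b ≡ L₁ * a + 2 * n₁ * b → Σ₂ + L₂ * b + k * b ≡ L₂ * a + 2 * n₂ * b →
      Σ₁ + Σ₂ + (L₁ + L₂) * b + suc k * b ≡ (L₁ + L₂) * a + 2 * (n₁ + n₂) * b
    combine Σ₁ Σ₂ L₁ L₂ k b a n₁ n₂ eq₁ eq₂ =
      trans (split Σ₁ Σ₂ L₁ L₂ k b) (trans (cong₂ _+_ eq₁ eq₂) (merge L₁ L₂ a n₁ n₂ b))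
      where
      split : ∀ Σ₁ Σ₂ L₁ L₂ k b → Σ₁ + Σ₂ + (L₁ + L₂) * b + suc k * b ≡ (Σ₁ + L₁ * b + b) + (Σ₂ + L₂ * b + k * b)
      split = solve-∀
      merge : ∀ L₁ L₂ a n₁ n₂ b → (L₁ * a + 2 * n₁ * b) + (L₂ * a + 2 * n₂ * b) ≡ (L₁ + L₂) * a + 2 * (n₁ + n₂) * b
      merge = solve-∀

private
  -- the three nested layers of forests (suc k) L (suc s): the size a of the children of the first tree,
  -- its root l, and its children cs
  firstChildren : ℕ → List ℕ → ℕ → ℕ → ℕ → List PTree → List (List PTree)
  firstChildren k L s a l cs = map (node l cs ∷_) (forests k L (s ∸ a))

  firstRoot : ℕ → List ℕ → ℕ → ℕ → ℕ → List (List PTree)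
  firstRoot k L s a l = concatMap (firstChildren k L s a l) (forests k L a)

  firstSize : ℕ → List ℕ → ℕ → ℕ → List (List PTree)
  firstSize k L s a = concatMap (firstRoot k L s a) L

  ∈-forests-suc⁻ : ∀ k L s {f} → f ∈ forests (suc k) L (suc s) →
    ∃ λ a → a ∈ upTo (suc s) × ∃ λ l → l ∈ L × ∃ λ cs → cs ∈ forests k L a × ∃ λ rest → rest ∈ forests k L (s ∸ a) ×
    f ≡ node l cs ∷ rest
  ∈-forests-suc⁻ k L s f∈ with ∈-concatMap⁻′ (firstSize k L s) (upTo (suc s)) f∈
  ... | a , a∈ , f∈₁ with ∈-concatMap⁻′ (firstRoot k L s a) L f∈₁
  ... | l , l∈ , f∈₂ with ∈-concatMap⁻′ (firstChildren k L s a l) (forests k L a) f∈₂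
  ... | cs , cs∈ , f∈₃ with ∈-map⁻ (node l cs ∷_) f∈₃
  ... | rest , rest∈ , eq = a , a∈ , l , l∈ , cs , cs∈ , rest , rest∈ , eq

sizeF-∷ : ∀ l cs rest → sizeF (node l cs ∷ rest) ≡ suc (sizeF cs + sizeF rest)
sizeF-∷ l cs rest = cong suc (length-++ (labelsF cs) {labelsF rest})

∈-forests⁻ : ∀ k L s {f} → f ∈ forests k L s → sizeF f ≡ s × (∀ {y} → y ∈ labelsF f → y ∈ L)
∈-forests⁻ (suc k) L zero    (here refl) = refl , λ ()
∈-forests⁻ (suc k) L (suc s) f∈ with ∈-forests-suc⁻ k L s f∈
... | a , a∈ , l , l∈ , cs , cs∈ , rest , rest∈ , refl =
  trans (sizeF-∷ l cs rest) (cong suc (trans (cong₂ _+_ size-cs size-rest) (m+[n∸m]≡n (≤-pred (∈-upTo⁻ a∈))))) ,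
  labels
  where
  size-cs = proj₁ (∈-forests⁻ k L a cs∈)
  size-rest = proj₁ (∈-forests⁻ k L (s ∸ a) rest∈)
  labels : ∀ {y} → y ∈ labelsF (node l cs ∷ rest) → y ∈ L
  labels (here refl) = l∈
  labels (there y∈) with ∈-++⁻ (labelsF cs) y∈
  ... | inj₁ y∈cs   = proj₂ (∈-forests⁻ k L a cs∈) y∈cs
  ... | inj₂ y∈rest = proj₂ (∈-forests⁻ k L (s ∸ a) rest∈) y∈rest

∈-forests⁺ : ∀ k L s {f} → sizeF f ≡ s → s < k → (∀ {y} → y ∈ labelsF f → y ∈ L) → f ∈ forests k L s
∈-forests⁺ (suc k) L zero    {[]}               size s<k labels = here refl
∈-forests⁺ (suc k) L zero    {node l cs ∷ rest} size s<k labels = ⊥-elim (1+n≢0 (trans (sym (sizeF-∷ l cs rest)) size))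
∈-forests⁺ (suc k) L (suc s) {node l cs ∷ rest} size s<k labels =
  ∈-concatMap⁺′ (firstSize k L s) (∈-upTo⁺ (s≤s a≤s))
    (∈-concatMap⁺′ (firstRoot k L s a) (labels (here refl))
      (∈-concatMap⁺′ (firstChildren k L s a l)
        (∈-forests⁺ k L a refl (≤-<-trans a≤s s<k′) (labels ∘ there ∘ ∈-++⁺ˡ))
        (∈-map⁺ (node l cs ∷_)
          (∈-forests⁺ k L (s ∸ a) size-rest (≤-<-trans (m∸n≤m s a) s<k′) (labels ∘ there ∘ ∈-++⁺ʳ (labelsF cs))))))
  where
  a = sizeF cs
  a+rest≡s : a + sizeF rest ≡ s
  a+rest≡s = suc-injective (trans (sym (sizeF-∷ l cs rest)) size)
  a≤s : a ≤ s
  a≤s = subst (a ≤_) a+rest≡s (m≤m+n a (sizeF rest))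
  s<k′ : s < k
  s<k′ = ≤-pred s<k
  size-rest : sizeF rest ≡ s ∸ a
  size-rest = trans (sym (m+n∸m≡n a (sizeF rest))) (cong (_∸ a) a+rest≡s)

forests-unique : ∀ k L s → Unique L → Unique (forests k L s)
forests-unique zero    L s       uL = []
forests-unique (suc k) L zero    uL = [] ∷ []
forests-unique (suc k) L (suc s) uL =
  concatMap-unique (firstSize k L s) (Unique.upTo⁺ (suc s))
    (λ {a} _ → concatMap-unique (firstRoot k L s a) uL
      (λ {l} _ → concatMap-unique (firstChildren k L s a l) (forests-unique k L a uL)
        (λ _ → Unique.map⁺ ∷-injectiveʳ (forests-unique k L (s ∸ a) uL))
        (λ _ _ f∈ f∈′ → cong children (first-tree≡ (first-tree (∈-map⁻ _ f∈)) (first-tree (∈-map⁻ _ f∈′)))))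
      (λ _ _ f∈ f∈′ → cong root (first-tree≡ (proj₂ (∈-firstRoot⁻ f∈)) (proj₂ (∈-firstRoot⁻ f∈′)))))
    (λ _ _ f∈ f∈′ → let l , cs , cs∈ , e = ∈-firstSize⁻ f∈ ; l′ , cs′ , cs′∈ , e′ = ∈-firstSize⁻ f∈′ in
                    trans (sym (proj₁ (∈-forests⁻ k L _ cs∈)))
                          (trans (cong (sizeF ∘ children) (first-tree≡ e e′)) (proj₁ (∈-forests⁻ k L _ cs′∈))))
  where
  HeadedBy : PTree → List PTree → Set
  HeadedBy t f = ∃ λ rest → f ≡ t ∷ rest
  first-tree : ∀ {t f} {A : Set} {rs : List A} {g : A → List PTree} → (∃ λ r → r ∈ rs × f ≡ t ∷ g r) → HeadedBy t f
  first-tree (r , _ , eq) = _ , eq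
  first-tree≡ : ∀ {t t′ f} → HeadedBy t f → HeadedBy t′ f → t ≡ t′
  first-tree≡ (_ , eq) (_ , eq′) = ∷-injectiveˡ (trans (sym eq) eq′)
  ∈-firstRoot⁻ : ∀ {a l f} → f ∈ firstRoot k L s a l → ∃ λ cs → HeadedBy (node l cs) f
  ∈-firstRoot⁻ {a} {l} f∈ with ∈-concatMap⁻′ (firstChildren k L s a l) (forests k L a) f∈
  ... | cs , _ , f∈′ = cs , first-tree (∈-map⁻ _ f∈′)
  ∈-firstSize⁻ : ∀ {a f} → f ∈ firstSize k L s a → ∃ λ l → ∃ λ cs → cs ∈ forests k L a × HeadedBy (node l cs) f
  ∈-firstSize⁻ {a} f∈ with ∈-concatMap⁻′ (firstRoot k L s a) L f∈
  ... | l , _ , f∈′ with ∈-concatMap⁻′ (firstChildren k L s a l) (forests k L a) f∈′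
  ... | cs , cs∈ , f∈″ = l , cs , cs∈ , first-tree (∈-map⁻ _ f∈″)

∈-candidateTrees⁻ : ∀ n {t} → t ∈ candidateTrees n → sizeT t ≡ n × (∀ {y} → y ∈ labelsT t → y ∈ oneTo n)
∈-candidateTrees⁻ (suc m) t∈ with ∈-concatMap⁻′ (λ l → map (node l) (forests (suc m) (oneTo (suc m)) m)) (oneTo (suc m)) t∈
... | l , l∈ , t∈′ with ∈-map⁻ (node l) t∈′
... | cs , cs∈ , refl = let size , labels = ∈-forests⁻ (suc m) (oneTo (suc m)) m cs∈ in
  cong suc size , λ { (here refl) → l∈ ; (there y∈) → labels y∈ }

∈-candidateTrees⁺ : ∀ n {t} → sizeT t ≡ n → (∀ {y} → y ∈ labelsT t → y ∈ oneTo n) → t ∈ candidateTrees n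
∈-candidateTrees⁺ (suc m) {node l cs} size labels =
  ∈-concatMap⁺′ (λ l → map (node l) (forests (suc m) (oneTo (suc m)) m)) (labels (here refl))
    (∈-map⁺ (node l) (∈-forests⁺ (suc m) (oneTo (suc m)) m (suc-injective size) ≤-refl (labels ∘ there)))

candidateTrees-unique : ∀ n → Unique (candidateTrees n)
candidateTrees-unique zero    = []
candidateTrees-unique (suc m) =
  concatMap-unique (λ l → map (node l) (forests (suc m) (oneTo (suc m)) m)) (oneTo-unique (suc m))
    (λ _ → Unique.map⁺ node-injective (forests-unique (suc m) (oneTo (suc m)) m (oneTo-unique (suc m))))
    (λ _ _ t∈ t∈′ → trans (sym (root-∈-map-node _ t∈)) (root-∈-map-node _ t∈′))

record IsIPT (n : ℕ) (t : PTree) : Set where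
  field
    size≡      : sizeT t ≡ n
    occ≡1      : ∀ {k} → k ∈ oneTo n → occ k (labelsT t) ≡ 1
    root≡1     : root t ≡ 1
    increasing : T (increasingT t)

isIPTᵇ⇔ : ∀ n t → T (isIPTᵇ n t) ⇔ IsIPT n t
isIPTᵇ⇔ n t = mk⇔ to from
  where
  occᵇ = λ k → occ k (labelsT t) ≡ᵇ 1
  to : T (isIPTᵇ n t) → IsIPT n t
  to h = let size , h₁ = Equivalence.to T-∧ h ; occs , h₂ = Equivalence.to T-∧ h₁ ; r , inc = Equivalence.to T-∧ h₂ in
    record
    { size≡      = ≡ᵇ⇒≡ _ _ size
    ; occ≡1      = λ k∈ → ≡ᵇ⇒≡ _ _ (Equivalence.to (T-allᵇ occᵇ (oneTo n)) occs k∈)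
    ; root≡1     = ≡ᵇ⇒≡ _ _ r
    ; increasing = inc
    }
  from : IsIPT n t → T (isIPTᵇ n t)
  from ipt = Equivalence.from T-∧ (≡⇒≡ᵇ _ _ size≡ , Equivalence.from T-∧
    (Equivalence.from (T-allᵇ occᵇ (oneTo n)) (λ k∈ → ≡⇒≡ᵇ _ _ (occ≡1 k∈)) ,
     Equivalence.from T-∧ (≡⇒≡ᵇ _ _ root≡1 , increasing)))
    where open IsIPT ipt

module _ (m : ℕ) where

  private
    n = suc m
    x = suc n

    x∈oneTo : x ∈ oneTo x
    x∈oneTo = ∈-oneTo⁺ (s≤s z≤n) ≤-refl

    x∉candidate : ∀ {t} → t ∈ candidateTrees n → x ∉ labelsT t
    x∉candidate t∈ x∈ = ∈-oneTo⇒≢suc (proj₂ (∈-candidateTrees⁻ n t∈) x∈) refl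

  addLeaf-ipt : ∀ {t t′} → t ∈ candidateTrees n → IsIPT n t → t′ ∈ addLeaf x t →
                t′ ∈ candidateTrees x × IsIPT x t′
  addLeaf-ipt {t} {t′} t∈ ipt t′∈ with addLeaf-insertion x t t′∈
  ... | u , v , eq₁ , eq₂ = ∈-candidateTrees⁺ x size labels , record
    { size≡ = size ; occ≡1 = occ≡1′ ; root≡1 = trans (addLeaf-root x t t′∈) root≡1
    ; increasing = addLeaf-increasing x t increasing (λ y∈ → s≤s (proj₂ (∈-oneTo⁻ (t-labels y∈)))) t′∈ }
    where
    open IsIPT ipt
    t-labels = proj₂ (∈-candidateTrees⁻ n t∈)
    size : sizeT t′ ≡ x
    size = trans (addLeaf-size x t t′∈) (cong suc size≡)
    labels : ∀ {y} → y ∈ labelsT t′ → y ∈ oneTo x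
    labels y∈ with ∈-insert⁻ u v (subst (_ ∈_) eq₂ y∈)
    ... | inj₁ refl = x∈oneTo
    ... | inj₂ y∈uv = ∈-oneTo-suc⁺ (t-labels (subst (_ ∈_) (sym eq₁) y∈uv))
    occ≡1′ : ∀ {k} → k ∈ oneTo x → occ k (labelsT t′) ≡ 1
    occ≡1′ {k} k∈ rewrite eq₂ with k ≟ x
    ... | yes refl = trans (occ-insert-≡ x u v) (cong suc (subst (λ w → occ x w ≡ 0) eq₁ (∉⇒occ≡0 x _ (x∉candidate t∈))))
    ... | no  k≢x  = trans (occ-insert-≢ u v k≢x) (subst (λ w → occ k w ≡ 1) eq₁ (occ≡1 (∈-oneTo-suc⁻ k∈ k≢x)))

  addLeaf-removeLeaf-ipt : ∀ {t′} → t′ ∈ candidateTrees x → IsIPT x t′ → t′ ∈ addLeaf x (removeLeaf x t′)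
  addLeaf-removeLeaf-ipt {t′} t′∈ ipt′ =
    addLeaf-removeLeaf x t′ (λ root≡x → 0≢1+n (suc-injective (trans (sym root≡1) root≡x))) (occ≡1 x∈oneTo)
      (λ y∈ → proj₂ (∈-oneTo⁻ (proj₂ (∈-candidateTrees⁻ x t′∈) y∈))) increasing
    where open IsIPT ipt′

  removeLeaf-ipt : ∀ {t′} → t′ ∈ candidateTrees x → IsIPT x t′ →
                   removeLeaf x t′ ∈ candidateTrees n × IsIPT n (removeLeaf x t′)
  removeLeaf-ipt {t′} t′∈ ipt′ with addLeaf-insertion x (removeLeaf x t′) (addLeaf-removeLeaf-ipt t′∈ ipt′)
  ... | ins@(u , v , eq₁ , eq₂) = ∈-candidateTrees⁺ n size labels , record
    { size≡ = size ; occ≡1 = occ≡1′ ; root≡1 = trans (root-removeLeaf t′) root≡1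
    ; increasing = removeLeaf-increasing x t′ increasing }
    where
    open IsIPT ipt′
    t = removeLeaf x t′
    root-removeLeaf : ∀ t′ → root (removeLeaf x t′) ≡ root t′
    root-removeLeaf (node _ _) = refl
    size : sizeT t ≡ n
    size = suc-injective (trans (sym (insertion-length ins)) size≡)
    occ-x≡0 : occ x (labelsT t) ≡ 0
    occ-x≡0 = subst (λ w → occ x w ≡ 0) (sym eq₁)
      (suc-injective (trans (sym (occ-insert-≡ x u v)) (subst (λ w → occ x w ≡ 1) eq₂ (occ≡1 x∈oneTo))))
    labels : ∀ {y} → y ∈ labelsT t → y ∈ oneTo n
    labels {y} y∈ = ∈-oneTo-suc⁻ (proj₂ (∈-candidateTrees⁻ x t′∈) (insertion-∈⁺ ins y∈))
                                 (λ { refl → occ≡0⇒∉ x (labelsT t) occ-x≡0 y∈ })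
    occ≡1′ : ∀ {k} → k ∈ oneTo n → occ k (labelsT t) ≡ 1
    occ≡1′ {k} k∈ = subst (λ w → occ k w ≡ 1) (sym eq₁)
      (trans (sym (occ-insert-≢ u v (∈-oneTo⇒≢suc k∈))) (subst (λ w → occ k w ≡ 1) eq₂ (occ≡1 (∈-oneTo-suc⁺ k∈))))

  treeInsertions : List PTree
  treeInsertions = concatMap (addLeaf x) (filterᵇ (isIPTᵇ n) (candidateTrees n))

  private
    ∈-ipts⁻ : ∀ {t} → t ∈ filterᵇ (isIPTᵇ n) (candidateTrees n) → t ∈ candidateTrees n × IsIPT n t
    ∈-ipts⁻ t∈ = let t∈′ , ipt = ∈-filter⁻ (T? ∘ isIPTᵇ n) t∈ in t∈′ , Equivalence.to (isIPTᵇ⇔ n _) ipt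

  ∈-treeInsertions⁺ : ∀ {t′} → t′ ∈ candidateTrees x → IsIPT x t′ → t′ ∈ treeInsertions
  ∈-treeInsertions⁺ t′∈ ipt′ = let t∈ , ipt = removeLeaf-ipt t′∈ ipt′ in
    ∈-concatMap⁺′ (addLeaf x) (∈-filter⁺ (T? ∘ isIPTᵇ n) t∈ (Equivalence.from (isIPTᵇ⇔ n _) ipt))
      (addLeaf-removeLeaf-ipt t′∈ ipt′)

  ∈-treeInsertions⁻ : ∀ {t′} → t′ ∈ treeInsertions → t′ ∈ candidateTrees x × T (isIPTᵇ x t′)
  ∈-treeInsertions⁻ t′∈ with ∈-concatMap⁻′ (addLeaf x) (filterᵇ (isIPTᵇ n) (candidateTrees n)) t′∈
  ... | t , t∈ , t′∈′ = let t∈′ , ipt = ∈-ipts⁻ t∈ ; t′∈″ , ipt′ = addLeaf-ipt t∈′ ipt t′∈′ in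
    t′∈″ , Equivalence.from (isIPTᵇ⇔ x _) ipt′

  treeInsertions-unique : Unique treeInsertions
  treeInsertions-unique =
    concatMap-unique (addLeaf x) (Unique.filter⁺ (T? ∘ isIPTᵇ n) (candidateTrees-unique n))
      (λ t∈ → addLeaf-unique x _ (x∉candidate (proj₁ (∈-ipts⁻ t∈))))
      (λ t∈ t₂∈ t′∈ t′∈₂ → trans (sym (removeLeaf-addLeaf x _ (x∉candidate (proj₁ (∈-ipts⁻ t∈))) t′∈))
                                 (removeLeaf-addLeaf x _ (x∉candidate (proj₁ (∈-ipts⁻ t₂∈))) t′∈₂))

iptsWithLeaves : ℕ → ℕ → ℕ
iptsWithLeaves n j = countᵇ (λ t → isIPTᵇ n t ∧ (leaves t ≡ᵇ j)) (candidateTrees n)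

module _ (m : ℕ) where

  private
    n = suc m
    x = suc n

  open ChildCount (isIPTᵇ n) leaves (suc (2 * m)) (candidateTrees n)

  ipts≡count : ∀ j → iptsWithLeaves n j ≡ count j
  ipts≡count j = trans (countᵇ≡∑𝟙 (λ t → isIPTᵇ n t ∧ (leaves t ≡ᵇ j)) (candidateTrees n))
                       (sumBy-cong (candidateTrees n) (λ {t} _ → 𝟙-∧ (isIPTᵇ n t) (leaves t ≡ᵇ j)))

  leafChildren : ℕ → PTree → ℕ
  leafChildren j t = ∑[ t′ ← addLeaf x t ] 𝟙 (leaves t′ ≡ᵇ j)

  ipts-suc≡children : ∀ j → iptsWithLeaves x j ≡ ∑[ t ← candidateTrees n ] (𝟙 (isIPTᵇ n t) * leafChildren j t)
  ipts-suc≡children j = begin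
    iptsWithLeaves x j                                    ≡⟨ countᵇ≡∑𝟙 (λ t → isIPTᵇ x t ∧ (leaves t ≡ᵇ j)) trees ⟩
    ∑[ t ← trees ] 𝟙 (isIPTᵇ x t ∧ (leaves t ≡ᵇ j))       ≡⟨ sumBy-cong trees (λ {t} _ → 𝟙-∧ (isIPTᵇ x t) (leaves t ≡ᵇ j)) ⟩
    ∑[ t ← trees ] (𝟙 (isIPTᵇ x t) * 𝟙 (leaves t ≡ᵇ j))  ≡⟨ reindex ⟩
    ∑[ t ← treeInsertions m ] 𝟙 (leaves t ≡ᵇ j)          ≡⟨ sumBy-concatMap (λ t → 𝟙 (leaves t ≡ᵇ j)) (addLeaf x) ipts ⟩
    ∑[ t ← ipts ] leafChildren j t                        ≡⟨ sumBy-filterᵇ (isIPTᵇ n) (leafChildren j) (candidateTrees n) ⟩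
    ∑[ t ← candidateTrees n ] (𝟙 (isIPTᵇ n t) * leafChildren j t) ∎
    where
    open ≡-Reasoning
    trees = candidateTrees x
    ipts = filterᵇ (isIPTᵇ n) (candidateTrees n)
    reindex : ∑[ t ← trees ] (𝟙 (isIPTᵇ x t) * 𝟙 (leaves t ≡ᵇ j)) ≡ ∑[ t ← treeInsertions m ] 𝟙 (leaves t ≡ᵇ j)
    reindex = sumBy-filterᵇ-sameElements (isIPTᵇ x) (λ t → 𝟙 (leaves t ≡ᵇ j))
      (candidateTrees-unique x) (treeInsertions-unique m)
      (λ {t} t∈ iptᵇ → ∈-treeInsertions⁺ m t∈ (Equivalence.to (isIPTᵇ⇔ x t) iptᵇ)) (∈-treeInsertions⁻ m)

  -- A tree on [n] has 2n − 1 = 2m + 1 places for the new leaf.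
  leafChildren-splits : ∀ j → Splits (leafChildren j) j
  leafChildren-splits j {t} t∈ _ =
    +-cancelʳ-≡ b _ _ (trans (addLeaf-leaves x (λ d → 𝟙 (d ≡ᵇ j)) t)
      (trans (cong (λ s → L * 𝟙 (L ≡ᵇ j) + 2 * s * b) (proj₁ (∈-candidateTrees⁻ n t∈))) (2n≡2m+1+1 L (𝟙 (L ≡ᵇ j)) b m)))
    where
    L = leaves t
    b = 𝟙 (suc L ≡ᵇ j)
    2n≡2m+1+1 : ∀ L e b m → L * e + 2 * suc m * b ≡ L * e + suc (2 * m) * b + b
    2n≡2m+1+1 = solve-∀

  ipts-suc-zero : iptsWithLeaves x 0 ≡ 0
  ipts-suc-zero = trans (ipts-suc≡children 0) (children-zero (leafChildren 0) (leafChildren-splits 0))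

  ipts-suc-step : ∀ j → iptsWithLeaves x (suc j) + j * iptsWithLeaves n j ≡
                        suc j * iptsWithLeaves n (suc j) + suc (2 * m) * iptsWithLeaves n j
  ipts-suc-step j = begin
    iptsWithLeaves x (suc j) + j * iptsWithLeaves n j
      ≡⟨ cong₂ (λ s t → s + j * t) (ipts-suc≡children (suc j)) (ipts≡count j) ⟩
    _ ≡⟨ children-suc (leafChildren (suc j)) j (leafChildren-splits (suc j)) ⟩
    _ ≡⟨ cong₂ (λ s t → suc j * s + suc (2 * m) * t) (ipts≡count (suc j)) (ipts≡count j) ⟨
    suc j * iptsWithLeaves n (suc j) + suc (2 * m) * iptsWithLeaves n j ∎
    where open ≡-Reasoning

ipts-eulerianRecurrence : EulerianRecurrence (λ m → iptsWithLeaves (suc m))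
ipts-eulerianRecurrence = record { at-zero = ipts-suc-zero ; step = ipts-suc-step }

C≡iptsWithLeaves : ∀ m j → C (suc m) j ≡ iptsWithLeaves (2 + m) j
C≡iptsWithLeaves = eulerianRecurrence-unique C-eulerianRecurrence ipts-eulerianRecurrence order-one
  where
  order-one : ∀ j → C 1 j ≡ iptsWithLeaves 2 j
  order-one zero          = refl
  order-one (suc zero)    = refl
  order-one (suc (suc j)) = refl

∑-upTo-𝟙≡ᵇ : ∀ N a (g : ℕ → ℕ) → ∑[ b ← upTo N ] (𝟙 (a ≡ᵇ b) * g b) ≡ 𝟙 (a <ᵇ N) * g a
∑-upTo-𝟙≡ᵇ zero    a g = refl
∑-upTo-𝟙≡ᵇ (suc N) a g = begin
  ∑[ b ← upTo (suc N) ] (𝟙 (a ≡ᵇ b) * g b)              ≡⟨ cong (sumBy (λ b → 𝟙 (a ≡ᵇ b) * g b)) (sym (upTo-∷ʳ N)) ⟩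
  ∑[ b ← upTo N ++ N ∷ [] ] (𝟙 (a ≡ᵇ b) * g b)          ≡⟨ sumBy-++ (λ b → 𝟙 (a ≡ᵇ b) * g b) (upTo N) (N ∷ []) ⟩
  ∑[ b ← upTo N ] (𝟙 (a ≡ᵇ b) * g b) + (𝟙 (a ≡ᵇ N) * g N + 0)
                                                         ≡⟨ cong (_+ (𝟙 (a ≡ᵇ N) * g N + 0)) (∑-upTo-𝟙≡ᵇ N a g) ⟩
  𝟙 (a <ᵇ N) * g a + (𝟙 (a ≡ᵇ N) * g N + 0)              ≡⟨ last (<-cmp a N) ⟩
  𝟙 (a <ᵇ suc N) * g a                                   ∎
  where
  open ≡-Reasoning
  last : Tri (a < N) (a ≡ N) (N < a) → 𝟙 (a <ᵇ N) * g a + (𝟙 (a ≡ᵇ N) * g N + 0) ≡ 𝟙 (a <ᵇ suc N) * g a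
  last (tri< a<N a≢N _)
    rewrite <⇒<ᵇ≡true a<N | <⇒<ᵇ≡true (m≤n⇒m≤1+n a<N) | ≢⇒≡ᵇ≡false a≢N = +-identityʳ _
  last (tri≈ _ refl _)
    rewrite ≤⇒>ᵇ≡false (≤-refl {a}) | <⇒<ᵇ≡true (≤-refl {suc a}) | ≡ᵇ-refl a = +-identityʳ _
  last (tri> _ a≢N N<a)
    rewrite ≤⇒>ᵇ≡false (<⇒≤ N<a) | ≤⇒>ᵇ≡false N<a | ≢⇒≡ᵇ≡false a≢N = refl

𝟙-≤∧≡∸ : ∀ a s t → 𝟙 (a <ᵇ suc t) * 𝟙 (s ≡ᵇ t ∸ a) ≡ 𝟙 (a + s ≡ᵇ t)
𝟙-≤∧≡∸ a s t with a ≤? t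
... | yes a≤t rewrite <⇒<ᵇ≡true (s≤s a≤t) = trans (+-identityʳ _) (cong 𝟙 (same-truth
      (λ h → ≡⇒≡ᵇ (a + s) t (trans (cong (a +_) (≡ᵇ⇒≡ s (t ∸ a) h)) (m+[n∸m]≡n a≤t)))
      (λ h → ≡⇒≡ᵇ s (t ∸ a) (trans (sym (m+n∸m≡n a s)) (cong (_∸ a) (≡ᵇ⇒≡ (a + s) t h))))))
  where
  same-truth : ∀ {b c} → (T b → T c) → (T c → T b) → b ≡ c
  same-truth {true}  {true}  _ _ = refl
  same-truth {true}  {false} f _ = ⊥-elim (f tt)
  same-truth {false} {true}  _ g = ⊥-elim (g tt)
  same-truth {false} {false} _ _ = refl
... | no a≰t rewrite ≤⇒>ᵇ≡false (≰⇒> a≰t) =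
  sym (cong 𝟙 (¬T⇒≡false (λ h → a≰t (subst (a ≤_) (≡ᵇ⇒≡ (a + s) t h) (m≤m+n a s)))))

weakComps-count : ∀ p t (r : List ℕ) → length r ≡ p → ∑[ is ← weakComps p t ] 𝟙 (listEqᵇ r is) ≡ 𝟙 (sum r ≡ᵇ t)
weakComps-count zero    zero    [] _ = refl
weakComps-count zero    (suc t) [] _ = refl
weakComps-count (suc p) t (a ∷ r) len = begin
  ∑[ is ← weakComps (suc p) t ] 𝟙 (listEqᵇ (a ∷ r) is)
    ≡⟨ sumBy-concatMap (λ is → 𝟙 (listEqᵇ (a ∷ r) is)) (λ b → map (b ∷_) (weakComps p (t ∸ b))) (upTo (suc t)) ⟩
  ∑[ b ← upTo (suc t) ] ∑[ is ← map (b ∷_) (weakComps p (t ∸ b)) ] 𝟙 (listEqᵇ (a ∷ r) is)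
    ≡⟨ sumBy-cong (upTo (suc t)) (λ {b} _ → split b) ⟩
  ∑[ b ← upTo (suc t) ] (𝟙 (a ≡ᵇ b) * 𝟙 (sum r ≡ᵇ t ∸ b))
    ≡⟨ ∑-upTo-𝟙≡ᵇ (suc t) a (λ b → 𝟙 (sum r ≡ᵇ t ∸ b)) ⟩
  𝟙 (a <ᵇ suc t) * 𝟙 (sum r ≡ᵇ t ∸ a)
    ≡⟨ 𝟙-≤∧≡∸ a (sum r) t ⟩
  𝟙 (a + sum r ≡ᵇ t) ∎
  where
  open ≡-Reasoning
  split : ∀ b → ∑[ is ← map (b ∷_) (weakComps p (t ∸ b)) ] 𝟙 (listEqᵇ (a ∷ r) is) ≡ 𝟙 (a ≡ᵇ b) * 𝟙 (sum r ≡ᵇ t ∸ b)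
  split b = begin
    ∑[ is ← map (b ∷_) (weakComps p (t ∸ b)) ] 𝟙 (listEqᵇ (a ∷ r) is)
      ≡⟨ sumBy-map (λ is → 𝟙 (listEqᵇ (a ∷ r) is)) (b ∷_) (weakComps p (t ∸ b)) ⟩
    ∑[ is ← weakComps p (t ∸ b) ] 𝟙 ((a ≡ᵇ b) ∧ listEqᵇ r is)
      ≡⟨ sumBy-cong (weakComps p (t ∸ b)) (λ {is} _ → 𝟙-∧ (a ≡ᵇ b) (listEqᵇ r is)) ⟩
    ∑[ is ← weakComps p (t ∸ b) ] (𝟙 (a ≡ᵇ b) * 𝟙 (listEqᵇ r is))
      ≡⟨ sumBy-*ˡ (𝟙 (a ≡ᵇ b)) (λ is → 𝟙 (listEqᵇ r is)) (weakComps p (t ∸ b)) ⟩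
    𝟙 (a ≡ᵇ b) * ∑[ is ← weakComps p (t ∸ b) ] 𝟙 (listEqᵇ r is)
      ≡⟨ cong (𝟙 (a ≡ᵇ b) *_) (weakComps-count p (t ∸ b) r (suc-injective len)) ⟩
    𝟙 (a ≡ᵇ b) * 𝟙 (sum r ≡ᵇ t ∸ b) ∎

length≤sizeF : ∀ cs → length cs ≤ sizeF cs
length≤sizeF []               = z≤n
length≤sizeF (node l ds ∷ cs) =
  subst (suc (length cs) ≤_) (sym (sizeF-∷ l ds cs)) (s≤s (≤-trans (length≤sizeF cs) (m≤n+m _ _)))

mutual
  nChildren-total : ∀ N t → sizeT t ≤ N → ∑[ k ← upTo N ] nChildrenT k t ≡ sizeT t
  nChildren-total N (node l cs) size≤N = begin
    ∑[ k ← upTo N ] (𝟙 (length cs ≡ᵇ k) + nChildrenF k cs)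
      ≡⟨ sumBy-+ (λ k → 𝟙 (length cs ≡ᵇ k)) (λ k → nChildrenF k cs) (upTo N) ⟩
    ∑[ k ← upTo N ] 𝟙 (length cs ≡ᵇ k) + ∑[ k ← upTo N ] nChildrenF k cs
      ≡⟨ cong₂ _+_ own-count (nChildrenF-total N cs (≤-trans (n≤1+n _) size≤N)) ⟩
    suc (sizeF cs) ∎
    where
    open ≡-Reasoning
    own-count : ∑[ k ← upTo N ] 𝟙 (length cs ≡ᵇ k) ≡ 1
    own-count = begin
      ∑[ k ← upTo N ] 𝟙 (length cs ≡ᵇ k)       ≡⟨ sumBy-cong (upTo N) (λ {k} _ → sym (*-identityʳ (𝟙 (length cs ≡ᵇ k)))) ⟩
      ∑[ k ← upTo N ] (𝟙 (length cs ≡ᵇ k) * 1) ≡⟨ ∑-upTo-𝟙≡ᵇ N (length cs) (λ _ → 1) ⟩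
      𝟙 (length cs <ᵇ N) * 1
        ≡⟨ cong (λ b → 𝟙 b * 1) (<⇒<ᵇ≡true (≤-trans (s≤s (length≤sizeF cs)) size≤N)) ⟩
      1                                          ∎

  nChildrenF-total : ∀ N cs → sizeF cs ≤ N → ∑[ k ← upTo N ] nChildrenF k cs ≡ sizeF cs
  nChildrenF-total N []       _     = sumBy-0 (upTo N)
  nChildrenF-total N (c ∷ cs) size≤N rewrite length-++ (labelsT c) {labelsF cs} =
    trans (sumBy-+ (λ k → nChildrenT k c) (λ k → nChildrenF k cs) (upTo N))
          (cong₂ _+_ (nChildren-total N c (≤-trans (m≤m+n _ _) size≤N)) (nChildrenF-total N cs (≤-trans (m≤n+m _ _) size≤N)))

-- The profile of a tree on n vertices is a weak composition of n, so exactly one term of the sum can be 1.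
profiles-count : ∀ n j t → sizeT t ≡ suc n →
  ∑[ is ← weakComps n (suc n ∸ j) ] 𝟙 (listEqᵇ (profile (suc n) t) (j ∷ is)) ≡ 𝟙 (leaves t ≡ᵇ j)
profiles-count n j t size = begin
  ∑[ is ← W ] 𝟙 ((leaves t ≡ᵇ j) ∧ listEqᵇ r is)    ≡⟨ sumBy-cong W (λ {is} _ → 𝟙-∧ (leaves t ≡ᵇ j) (listEqᵇ r is)) ⟩
  ∑[ is ← W ] (𝟙 (leaves t ≡ᵇ j) * 𝟙 (listEqᵇ r is)) ≡⟨ sumBy-*ˡ (𝟙 (leaves t ≡ᵇ j)) (λ is → 𝟙 (listEqᵇ r is)) W ⟩
  𝟙 (leaves t ≡ᵇ j) * ∑[ is ← W ] 𝟙 (listEqᵇ r is)   ≡⟨ cong (𝟙 (leaves t ≡ᵇ j) *_) (weakComps-count n (suc n ∸ j) r length-r) ⟩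
  𝟙 (leaves t ≡ᵇ j) * 𝟙 (sum r ≡ᵇ suc n ∸ j)         ≡⟨ rest-sum (leaves t ≡ᵇ j) refl ⟩
  𝟙 (leaves t ≡ᵇ j)                                   ∎
  where
  open ≡-Reasoning
  W = weakComps n (suc n ∸ j)
  r = map (λ k → nChildrenT k t) (applyUpTo suc n)
  length-r : length r ≡ n
  length-r = trans (length-map _ (applyUpTo suc n)) (length-applyUpTo suc n)
  total : leaves t + sum r ≡ suc n
  total = trans (nChildren-total (suc n) t (≤-reflexive size)) size
  rest-sum : ∀ b → (leaves t ≡ᵇ j) ≡ b → 𝟙 b * 𝟙 (sum r ≡ᵇ suc n ∸ j) ≡ 𝟙 b
  rest-sum false _ = refl
  rest-sum true  leaves≡j rewrite sym (≡ᵇ⇒≡ (leaves t) j (subst T (sym leaves≡j) tt)) =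
    cong (λ b → 𝟙 b + 0) (Equivalence.to T-≡ (≡⇒≡ᵇ _ _ (trans (sym (m+n∸m≡n (leaves t) _)) (cong (_∸ leaves t) total))))

γ-sum≡iptsWithLeaves : ∀ n j → ∑[ is ← weakComps n (suc n ∸ j) ] γ (suc n) (j ∷ is) ≡ iptsWithLeaves (suc n) j
γ-sum≡iptsWithLeaves n j = begin
  ∑[ is ← W ] γ (suc n) (j ∷ is)
    ≡⟨ sumBy-cong W (λ {is} _ → trans (countᵇ≡∑𝟙 (λ t → isIPTᵇ (suc n) t ∧ listEqᵇ (profile (suc n) t) (j ∷ is)) trees)
                                       (sumBy-cong trees (λ {t} _ → 𝟙-∧ (isIPTᵇ (suc n) t) _))) ⟩
  ∑[ is ← W ] ∑[ t ← trees ] (𝟙 (isIPTᵇ (suc n) t) * 𝟙 (listEqᵇ (profile (suc n) t) (j ∷ is)))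
    ≡⟨ sumBy-comm (λ is t → 𝟙 (isIPTᵇ (suc n) t) * 𝟙 (listEqᵇ (profile (suc n) t) (j ∷ is))) W trees ⟩
  ∑[ t ← trees ] ∑[ is ← W ] (𝟙 (isIPTᵇ (suc n) t) * 𝟙 (listEqᵇ (profile (suc n) t) (j ∷ is)))
    ≡⟨ sumBy-cong trees (λ {t} t∈ → trans (sumBy-*ˡ (𝟙 (isIPTᵇ (suc n) t)) _ W)
                                          (cong (𝟙 (isIPTᵇ (suc n) t) *_)
                                                (profiles-count n j t (proj₁ (∈-candidateTrees⁻ (suc n) t∈))))) ⟩
  ∑[ t ← trees ] (𝟙 (isIPTᵇ (suc n) t) * 𝟙 (leaves t ≡ᵇ j))
    ≡⟨ sumBy-cong trees (λ {t} _ → 𝟙-∧ (isIPTᵇ (suc n) t) (leaves t ≡ᵇ j)) ⟨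
  ∑[ t ← trees ] 𝟙 (isIPTᵇ (suc n) t ∧ (leaves t ≡ᵇ j))
    ≡⟨ countᵇ≡∑𝟙 (λ t → isIPTᵇ (suc n) t ∧ (leaves t ≡ᵇ j)) trees ⟨
  iptsWithLeaves (suc n) j ∎
  where
  open ≡-Reasoning
  W = weakComps n (suc n ∸ j)
  trees = candidateTrees (suc n)

corollary4p9 : (n j : ℕ) → 2 ≤ n → 1 ≤ j → j ≤ n ∸ 1 →
    C (n ∸ 1) j ≡ sum (map (λ is → γ n (j ∷ is)) (weakComps (n ∸ 1) (n ∸ j)))
-- The identity holds for every j.
corollary4p9 (suc (suc m)) j (s≤s (s≤s _)) _ _ = begin
  C (suc m) j                                       ≡⟨ C≡iptsWithLeaves m j ⟩
  iptsWithLeaves (2 + m) j                          ≡⟨ γ-sum≡iptsWithLeaves (suc m) j ⟨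
  ∑[ is ← weakComps (suc m) (2 + m ∸ j) ] γ (2 + m) (j ∷ is) ∎
  where open ≡-Reasoning
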